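{- Let $m,n>1$ and $1\le k\le\min\{m,n\}$, and let $\alpha\in[0,1]$. The $A_\alpha$-characteristic polynomial of $K_m\circ_k K_n$ is \begin{align*} \Phi(A_\alpha(K_m\circ_k K_n),\lambda)=&\big(\lambda-\alpha(m+n-k)+1\big)^{k-1}\big(\lambda-\alpha m+1\big)^{m-k-1}\big(\lambda-\alpha n+1\big)^{n-k-1}\\ &\cdot\Big(\big(\lambda-m+1+(1-\alpha)k\big)\big(\lambda-n+1+(1-\alpha)k\big)\big(\lambda-\alpha(m+n-2k)+1-k\big)\\ &\quad-(1-\alpha)^2k\big((m+n-2k)\lambda-(m+n-2k)\alpha k-(m-k)(n-k-1)-(n-k)(m-k-1)\big)\Big). \end{align*}
   Context: $K_m$ denotes the complete graph on $m$ vertices. For graphs $G_1,G_2$ each containing a clique of order $k$, the $k$-coalescence $G_1\circ_k G_2$ is obtained by choosing a $k$-clique in each graph and identifying these two cliques vertex by vertex. For a graph $G$, $A_\alpha(G)=\alpha D(G)+(1-\alpha)A(G)$, where $D(G)$ is the diagonal degree matrix and $A(G)$ the adjacency matrix, and $\Phi(M,\lambda)=\det(\lambda I-M)$. -}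

module Defs where

open import Level using (Level)
open import Data.Nat using (ℕ; zero; suc; _<ᵇ_; _≤ᵇ_; _<?_)
import Data.Nat as N
import Data.Fin as Fin
open import Data.Bool using (Bool; true; false; if_then_else_; _∨_; not)
open import Data.Maybe using (Maybe; just; nothing)
open import Data.Fin using (Fin; zero; suc; toℕ; fromℕ<; punchIn; _≟_)
open import Relation.Nullary using (yes; no)
open import Relation.Nullary.Decidable using (⌊_⌋)
open import Algebra.Bundles using (CommutativeRing)

Graph : ℕ → Set
Graph n = Fin n → Fin n → Bool

complete : (n : ℕ) → Graph n
complete n i j = not ⌊ i ≟ j ⌋

toFin : (n : ℕ) → ℕ → Maybe (Fin n)
toFin n x with x <? n
... | yes p = just (fromℕ< p)
... | no _  = nothing

liftAdj : {n : ℕ} → Graph n → Maybe (Fin n) → Maybe (Fin n) → Bool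
liftAdj G (just a) (just b) = G a b
liftAdj G _        _        = false

-- k-coalescence G ∘_k H of G on Fin m and H on Fin n, identifying the
-- clique {0,…,k-1} of G with the clique {0,…,k-1} of H vertex by vertex.
-- Vertex set Fin (m + n ∸ k):
--   0 … k-1        : identified vertices (vertex i of G = vertex i of H)
--   k … m-1        : remaining vertices of G (vertex i of G)
--   m … m+n-k-1    : remaining vertices of H (vertex x ↦ x - m + k of H)
-- Two vertices are adjacent iff they are adjacent in the copy of G or in
-- the copy of H.
gIdx : ℕ → ℕ → Maybe ℕ
gIdx m x = if x <ᵇ m then just x else nothing

hIdx : ℕ → ℕ → ℕ → Maybe ℕ
hIdx k m x = if x <ᵇ k then just x else (if m ≤ᵇ x then just ((x N.∸ m) N.+ k) else nothing)

toFinM : (n : ℕ) → Maybe ℕ → Maybe (Fin n)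
toFinM n (just x) = toFin n x
toFinM n nothing  = nothing

coalesce : {m n : ℕ} → Graph m → Graph n → (k : ℕ) → Graph (m N.+ n N.∸ k)
coalesce {m} {n} G H k u v =
  liftAdj G (toFinM m (gIdx m (toℕ u))) (toFinM m (gIdx m (toℕ v)))
  ∨ liftAdj H (toFinM n (hIdx k m (toℕ u))) (toFinM n (hIdx k m (toℕ v)))

countF : {n : ℕ} → (Fin n → Bool) → ℕ
countF {zero}  p = 0
countF {suc n} p = (if p zero then 1 else 0) N.+ countF (λ i → p (suc i))

degree : {n : ℕ} → Graph n → Fin n → ℕ
degree G v = countF (G v)

module RingDefs {c ℓ : Level} (R : CommutativeRing c ℓ) where
  open CommutativeRing R

  Matrix : ℕ → Set c
  Matrix n = Fin n → Fin n → Carrier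

  ι : ℕ → Carrier
  ι N.zero    = 0#
  ι (N.suc n) = 1# + ι n

  pow : Carrier → ℕ → Carrier
  pow x N.zero    = 1#
  pow x (N.suc e) = x * pow x e

  sumF : {n : ℕ} → (Fin n → Carrier) → Carrier
  sumF {N.zero}  f = 0#
  sumF {N.suc n} f = f Fin.zero + sumF (λ i → f (suc i))

  sgn : ℕ → Carrier
  sgn N.zero    = 1#
  sgn (N.suc i) = - sgn i

  det : {n : ℕ} → Matrix n → Carrier
  det {N.zero}  M = 1#
  det {N.suc n} M = sumF (λ j → sgn (toℕ j) * (M Fin.zero j * det (λ a b → M (suc a) (punchIn j b))))

  δ : {n : ℕ} → Fin n → Fin n → Carrier
  δ i j = if ⌊ i ≟ j ⌋ then 1# else 0#

  adjM : {n : ℕ} → Graph n → Matrix n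
  adjM G i j = if G i j then 1# else 0#

  degM : {n : ℕ} → Graph n → Matrix n
  degM G i j = δ i j * ι (degree G i)

  Aα : {n : ℕ} → Carrier → Graph n → Matrix n
  Aα α G i j = α * degM G i j + (1# - α) * adjM G i j

  Φ : {n : ℕ} → Matrix n → Carrier → Carrier
  Φ M x = det (λ i j → x * δ i j - M i j)

{-# OPTIONS --safe #-}
module Submission where

-- Order the vertices of K_m ∘_k K_n as the k shared vertices, the m − k vertices only in K_m
-- and the n − k vertices only in K_n. An entry of λI − A_α(K_m ∘_k K_n) is then
-- δ_uv t_b + o(b, b′), where b, b′ are the blocks of u, v, t_b = λ − α(d_b + 1) + 1 with d_b
-- the common degree in block b, and o(b, b′) = −(1 − α) if b and b′ lie in a common clique
-- and 0 otherwise. Linearity in the column of a vertex splits off its diagonal value t_b;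
-- once a vertex has diagonal 0, the column of the next vertex of its block agrees with its
-- own apart from the diagonal, so that vertex contributes only a factor t_b. A block of a
-- vertices therefore contributes t_b^a D + a t_b^(a−1) D′, which reduces the determinant to
-- determinants of order at most 3 and the theorem to a polynomial identity.

open import Level using (Level)
open import Data.Nat using (ℕ; _<_; _≤_; _≡ᵇ_; _<ᵇ_; _≤ᵇ_; z≤n; s≤s; _<?_)
import Data.Nat as N
import Data.Nat.Properties as NP
open import Data.Bool using (Bool; true; false; if_then_else_; _∧_; _∨_; not)
open import Data.Bool.Properties using (∧-identityʳ; ∧-zeroʳ; ∧-distribˡ-∨; T-≡; ¬-not)
open import Function.Bundles using (Equivalence)
open import Data.Empty using (⊥-elim)
open import Data.Maybe using (Maybe; just; nothing)
open import Data.Product using (_×_; _,_; proj₁; proj₂)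
open import Data.Sum using (_⊎_; inj₁; inj₂)
open import Data.Fin using (Fin; zero; suc; toℕ; fromℕ<; punchIn; punchOut; inject₁; _≟_)
import Data.Fin.Properties as FP
open import Data.Vec using (Vec; []; _∷_; lookup; removeAt; _[_]≔_; replicate; _++_)
open import Data.Vec.Properties using (lookup∘update; lookup∘update′; removeAt-punchOut)
open import Data.Integer using (ℤ; +_; -[1+_])
import Data.Integer as Z
import Data.Integer.Properties as ZP
open import Data.Sign using (Sign)
import Data.Sign as Sign
open import Relation.Binary.PropositionalEquality as P using (_≡_; _≢_; refl; cong; cong₂)
open import Relation.Nullary using (yes; no)
open import Relation.Nullary.Decidable using (⌊_⌋; toSum)
open import Algebra.Bundles using (CommutativeRing)
open import Algebra.Solver.Ring.AlmostCommutativeRing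
  using (fromCommutativeRing; _-Raw-AlmostCommutative⟶_)
import Relation.Binary.Reasoning.Setoid as SetoidReasoning
open import Defs

module IntegerCoefficients {c ℓ} (R : CommutativeRing c ℓ) where
  open CommutativeRing R renaming (refl to ≈-refl)
  open RingDefs R using (ι)
  open import Algebra.Properties.Ring ring using (-0#≈0#; -1*x≈-x; -‿involutive; -‿+-comm)
  open import Algebra.Properties.CommutativeSemigroup *-commutativeSemigroup using (interchange)
  open SetoidReasoning setoid

  ι-+ : ∀ m n → ι (m N.+ n) ≈ ι m + ι n
  ι-+ ℕ.zero    n = sym (+-identityˡ _)
  ι-+ (ℕ.suc m) n = trans (+-congˡ (ι-+ m n)) (sym (+-assoc _ _ _))

  ι-* : ∀ m n → ι (m N.* n) ≈ ι m * ι n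
  ι-* ℕ.zero    n = sym (zeroˡ _)
  ι-* (ℕ.suc m) n = begin
    ι (n N.+ m N.* n)     ≈⟨ ι-+ n (m N.* n) ⟩
    ι n + ι (m N.* n)     ≈⟨ +-cong (sym (*-identityˡ _)) (ι-* m n) ⟩
    1# * ι n + ι m * ι n  ≈⟨ sym (distribʳ _ _ _) ⟩
    (1# + ι m) * ι n      ∎

  -- Agrees with ι, but ι₁ 1 is 1# on the nose, so that the solver's constant 1 evaluates
  -- to the 1# occurring in goals.
  ι₁ : ℕ → Carrier
  ι₁ ℕ.zero                = 0#
  ι₁ (ℕ.suc ℕ.zero)        = 1#
  ι₁ (ℕ.suc (ℕ.suc n))     = 1# + ι₁ (ℕ.suc n)

  ι₁≈ι : ∀ n → ι₁ n ≈ ι n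
  ι₁≈ι ℕ.zero              = ≈-refl
  ι₁≈ι (ℕ.suc ℕ.zero)      = sym (+-identityʳ _)
  ι₁≈ι (ℕ.suc (ℕ.suc n))   = +-congˡ (ι₁≈ι (ℕ.suc n))

  ι₁-suc : ∀ n → ι₁ (ℕ.suc n) ≈ 1# + ι₁ n
  ι₁-suc n = trans (ι₁≈ι (ℕ.suc n)) (+-congˡ (sym (ι₁≈ι n)))

  ι₁-+ : ∀ m n → ι₁ (m N.+ n) ≈ ι₁ m + ι₁ n
  ι₁-+ m n = trans (ι₁≈ι (m N.+ n)) (trans (ι-+ m n) (sym (+-cong (ι₁≈ι m) (ι₁≈ι n))))

  ι₁-* : ∀ m n → ι₁ (m N.* n) ≈ ι₁ m * ι₁ n
  ι₁-* m n = trans (ι₁≈ι (m N.* n)) (trans (ι-* m n) (sym (*-cong (ι₁≈ι m) (ι₁≈ι n))))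

  fromℤ : ℤ → Carrier
  fromℤ (+ n)    = ι₁ n
  fromℤ -[1+ n ] = - ι₁ (ℕ.suc n)

  private
    cancel-1# : ∀ a b → (1# + a) + - (1# + b) ≈ a + - b
    cancel-1# a b = begin
      (1# + a) + - (1# + b)      ≈⟨ +-cong (+-comm _ _) (sym (-‿+-comm _ _)) ⟩
      (a + 1#) + (- 1# + - b)    ≈⟨ +-assoc _ _ _ ⟩
      a + (1# + (- 1# + - b))    ≈⟨ +-congˡ (sym (+-assoc _ _ _)) ⟩
      a + ((1# + - 1#) + - b)    ≈⟨ +-congˡ (+-congʳ (-‿inverseʳ _)) ⟩
      a + (0# + - b)             ≈⟨ +-congˡ (+-identityˡ _) ⟩
      a + - b                    ∎

    fromSign : Sign → Carrier
    fromSign Sign.+ = 1#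
    fromSign Sign.- = - 1#

    fromSign-* : ∀ s t → fromSign (s Sign.* t) ≈ fromSign s * fromSign t
    fromSign-* Sign.+ t      = sym (*-identityˡ _)
    fromSign-* Sign.- Sign.+ = sym (*-identityʳ _)
    fromSign-* Sign.- Sign.- = sym (trans (-1*x≈-x _) (-‿involutive _))

    fromℤ-◃ : ∀ s n → fromℤ (s Z.◃ n) ≈ fromSign s * ι₁ n
    fromℤ-◃ s      ℕ.zero    = sym (zeroʳ _)
    fromℤ-◃ Sign.+ (ℕ.suc n) = sym (*-identityˡ _)
    fromℤ-◃ Sign.- (ℕ.suc n) = sym (-1*x≈-x _)

    fromℤ-sign : ∀ i → fromℤ i ≈ fromSign (Z.sign i) * ι₁ Z.∣ i ∣
    fromℤ-sign (+ n)    = sym (*-identityˡ _)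
    fromℤ-sign -[1+ n ] = sym (-1*x≈-x _)

  fromℤ-⊖ : ∀ m n → fromℤ (m Z.⊖ n) ≈ ι₁ m + - ι₁ n
  fromℤ-⊖ m         ℕ.zero    = sym (trans (+-congˡ -0#≈0#) (+-identityʳ _))
  fromℤ-⊖ ℕ.zero    (ℕ.suc n) = sym (+-identityˡ _)
  fromℤ-⊖ (ℕ.suc m) (ℕ.suc n) = begin
    fromℤ (ℕ.suc m Z.⊖ ℕ.suc n)    ≈⟨ reflexive (cong fromℤ (ZP.[1+m]⊖[1+n]≡m⊖n m n)) ⟩
    fromℤ (m Z.⊖ n)                ≈⟨ fromℤ-⊖ m n ⟩
    ι₁ m + - ι₁ n                  ≈⟨ sym (cancel-1# _ _) ⟩
    (1# + ι₁ m) + - (1# + ι₁ n)    ≈⟨ sym (+-cong (ι₁-suc m) (-‿cong (ι₁-suc n))) ⟩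
    ι₁ (ℕ.suc m) + - ι₁ (ℕ.suc n)  ∎

  fromℤ-+ : ∀ i j → fromℤ (i Z.+ j) ≈ fromℤ i + fromℤ j
  fromℤ-+ -[1+ m ] -[1+ n ] = begin
    - ι₁ (ℕ.suc (ℕ.suc (m N.+ n)))      ≈⟨ -‿cong (reflexive (cong (λ z → ι₁ (ℕ.suc z)) (P.sym (NP.+-suc m n)))) ⟩
    - ι₁ (ℕ.suc m N.+ ℕ.suc n)          ≈⟨ -‿cong (ι₁-+ (ℕ.suc m) (ℕ.suc n)) ⟩
    - (ι₁ (ℕ.suc m) + ι₁ (ℕ.suc n))     ≈⟨ sym (-‿+-comm _ _) ⟩
    - ι₁ (ℕ.suc m) + - ι₁ (ℕ.suc n)     ∎
  fromℤ-+ -[1+ m ] (+ n)    = trans (fromℤ-⊖ n (ℕ.suc m)) (+-comm _ _)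
  fromℤ-+ (+ m)    -[1+ n ] = fromℤ-⊖ m (ℕ.suc n)
  fromℤ-+ (+ m)    (+ n)    = ι₁-+ m n

  fromℤ-* : ∀ i j → fromℤ (i Z.* j) ≈ fromℤ i * fromℤ j
  fromℤ-* i j = begin
    fromℤ ((Z.sign i Sign.* Z.sign j) Z.◃ (Z.∣ i ∣ N.* Z.∣ j ∣))
      ≈⟨ fromℤ-◃ (Z.sign i Sign.* Z.sign j) (Z.∣ i ∣ N.* Z.∣ j ∣) ⟩
    fromSign (Z.sign i Sign.* Z.sign j) * ι₁ (Z.∣ i ∣ N.* Z.∣ j ∣)
      ≈⟨ *-cong (fromSign-* (Z.sign i) (Z.sign j)) (ι₁-* Z.∣ i ∣ Z.∣ j ∣) ⟩
    (fromSign (Z.sign i) * fromSign (Z.sign j)) * (ι₁ Z.∣ i ∣ * ι₁ Z.∣ j ∣)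
      ≈⟨ interchange _ _ _ _ ⟩
    (fromSign (Z.sign i) * ι₁ Z.∣ i ∣) * (fromSign (Z.sign j) * ι₁ Z.∣ j ∣)
      ≈⟨ sym (*-cong (fromℤ-sign i) (fromℤ-sign j)) ⟩
    fromℤ i * fromℤ j
      ∎

  fromℤ-neg : ∀ i → fromℤ (Z.- i) ≈ - fromℤ i
  fromℤ-neg -[1+ n ]        = sym (-‿involutive _)
  fromℤ-neg (+ ℕ.zero)      = sym -0#≈0#
  fromℤ-neg (+ ℕ.suc n)     = ≈-refl

  fromℤ-morphism : Z.+-*-rawRing -Raw-AlmostCommutative⟶ fromCommutativeRing R
  fromℤ-morphism = record
    { ⟦_⟧    = fromℤ
    ; +-homo = fromℤ-+
    ; *-homo = fromℤ-*
    ; -‿homo = fromℤ-neg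
    ; 0-homo = ≈-refl
    ; 1-homo = ≈-refl
    }

  fromℤ-≟ : ∀ i j → Maybe (fromℤ i ≈ fromℤ j)
  fromℤ-≟ i j with i ZP.≟ j
  ... | yes refl = just ≈-refl
  ... | no _     = nothing

  open import Algebra.Solver.Ring Z.+-*-rawRing (fromCommutativeRing R) fromℤ-morphism fromℤ-≟ public

module Determinants {c ℓ} (R : CommutativeRing c ℓ) where
  open CommutativeRing R renaming (refl to ≈-refl) hiding (zero)
  open RingDefs R
  open IntegerCoefficients R using (solve; _:=_; _:+_; _:*_; :-_; con)
  open import Algebra.Properties.CommutativeSemigroup +-commutativeSemigroup using (interchange; x∙yz≈y∙xz)
  open SetoidReasoning setoid

  sumF-cong : ∀ {n} {f g : Fin n → Carrier} → (∀ i → f i ≈ g i) → sumF f ≈ sumF g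
  sumF-cong {ℕ.zero}  h = ≈-refl
  sumF-cong {ℕ.suc n} h = +-cong (h zero) (sumF-cong (λ i → h (suc i)))

  sumF-+ : ∀ {n} (f g : Fin n → Carrier) → sumF (λ i → f i + g i) ≈ sumF f + sumF g
  sumF-+ {ℕ.zero}  f g = sym (+-identityˡ 0#)
  sumF-+ {ℕ.suc n} f g = trans (+-congˡ (sumF-+ (λ i → f (suc i)) (λ i → g (suc i)))) (interchange _ _ _ _)

  sumF-*ˡ : ∀ {n} a (f : Fin n → Carrier) → sumF (λ i → a * f i) ≈ a * sumF f
  sumF-*ˡ {ℕ.zero}  a f = sym (zeroʳ a)
  sumF-*ˡ {ℕ.suc n} a f = trans (+-congˡ (sumF-*ˡ a (λ i → f (suc i)))) (sym (distribˡ a _ _))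

  sumF-zero : ∀ {n} (f : Fin n → Carrier) → (∀ i → f i ≈ 0#) → sumF f ≈ 0#
  sumF-zero {ℕ.zero}  f h = ≈-refl
  sumF-zero {ℕ.suc n} f h = trans (+-cong (h zero) (sumF-zero _ (λ i → h (suc i)))) (+-identityˡ 0#)

  sumF-punchIn : ∀ {n} (f : Fin (N.suc n) → Carrier) q → sumF f ≈ f q + sumF (λ j → f (punchIn q j))
  sumF-punchIn           f zero    = ≈-refl
  sumF-punchIn {ℕ.suc n} f (suc q) = trans (+-congˡ (sumF-punchIn (λ i → f (suc i)) q)) (x∙yz≈y∙xz _ _ _)

  sumF-adjacentPair : ∀ {n} (c : Fin n) (f : Fin (N.suc n) → Carrier) →
    (∀ j → j ≢ inject₁ c → j ≢ suc c → f j ≈ 0#) → f (inject₁ c) + f (suc c) ≈ 0# → sumF f ≈ 0#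
  sumF-adjacentPair zero f others pair = begin
    f zero + (f (suc zero) + sumF (λ i → f (suc (suc i))))  ≈⟨ sym (+-assoc _ _ _) ⟩
    (f zero + f (suc zero)) + sumF (λ i → f (suc (suc i)))  ≈⟨ +-cong pair (sumF-zero _ (λ i → others (suc (suc i)) (λ ()) (λ ()))) ⟩
    0# + 0#                                                ≈⟨ +-identityˡ _ ⟩
    0#                                                     ∎
  sumF-adjacentPair (suc c) f others pair =
    trans (+-cong (others zero (λ ()) (λ ()))
                  (sumF-adjacentPair c (λ i → f (suc i))
                     (λ j j≢ j≢′ → others (suc j) (λ e → j≢ (FP.suc-injective e)) (λ e → j≢′ (FP.suc-injective e))) pair))
          (+-identityˡ _)

  minor : ∀ {n} → Fin (N.suc n) → Fin (N.suc n) → Matrix (N.suc n) → Matrix n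
  minor p q M a b = M (punchIn p a) (punchIn q b)

  laplaceTerm : ∀ {n} → Matrix (N.suc n) → Fin (N.suc n) → Carrier
  laplaceTerm M j = sgn (toℕ j) * (M zero j * det (minor zero j M))

  det-cong : ∀ {n} {A B : Matrix n} → (∀ u v → A u v ≈ B u v) → det A ≈ det B
  det-cong {ℕ.zero}  h = ≈-refl
  det-cong {ℕ.suc n} {A} {B} h = sumF-cong {f = laplaceTerm A} {g = laplaceTerm B}
    (λ j → *-congˡ (*-cong (h zero j) (det-cong (λ a b → h (suc a) (punchIn j b)))))

  det-linearColumn : ∀ {n} (q : Fin n) (a : Carrier) (A B C : Matrix n) →
    (∀ u v → v ≢ q → A u v ≈ B u v) → (∀ u v → v ≢ q → A u v ≈ C u v) →
    (∀ u → A u q ≈ a * B u q + C u q) → det A ≈ a * det B + det C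
  det-linearColumn {ℕ.suc n} q a A B C A≈B A≈C column = begin
    sumF (laplaceTerm A)                                            ≈⟨ sumF-cong term ⟩
    sumF (λ j → a * laplaceTerm B j + laplaceTerm C j)              ≈⟨ sumF-+ (λ j → a * laplaceTerm B j) (laplaceTerm C) ⟩
    sumF (λ j → a * laplaceTerm B j) + sumF (laplaceTerm C)         ≈⟨ +-congʳ (sumF-*ˡ a (laplaceTerm B)) ⟩
    a * det B + det C                                               ∎
    where
    distrib₁ : ∀ a s b x d → s * ((a * b + x) * d) ≈ a * (s * (b * d)) + s * (x * d)
    distrib₁ = solve 5 (λ a s b x d → s :* ((a :* b :+ x) :* d) := a :* (s :* (b :* d)) :+ s :* (x :* d)) ≈-refl
    distrib₂ : ∀ a s x d e → s * (x * (a * d + e)) ≈ a * (s * (x * d)) + s * (x * e)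
    distrib₂ = solve 5 (λ a s x d e → s :* (x :* (a :* d :+ e)) := a :* (s :* (x :* d)) :+ s :* (x :* e)) ≈-refl
    term : ∀ j → laplaceTerm A j ≈ a * laplaceTerm B j + laplaceTerm C j
    term j with j ≟ q
    ... | yes refl = begin
      sgn (toℕ j) * (A zero j * det (minor zero j A))
        ≈⟨ *-congˡ (*-congʳ (column zero)) ⟩
      sgn (toℕ j) * ((a * B zero j + C zero j) * det (minor zero j A))
        ≈⟨ distrib₁ _ _ _ _ _ ⟩
      a * (sgn (toℕ j) * (B zero j * det (minor zero j A))) + sgn (toℕ j) * (C zero j * det (minor zero j A))
        ≈⟨ +-cong (*-congˡ (*-congˡ (*-congˡ (det-cong (λ u v → A≈B (suc u) (punchIn j v) (FP.punchInᵢ≢i j v))))))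
                  (*-congˡ (*-congˡ (det-cong (λ u v → A≈C (suc u) (punchIn j v) (FP.punchInᵢ≢i j v))))) ⟩
      a * laplaceTerm B j + laplaceTerm C j
        ∎
    ... | no j≢q = begin
      sgn (toℕ j) * (A zero j * det (minor zero j A))
        ≈⟨ *-congˡ (*-congˡ minor-linear) ⟩
      sgn (toℕ j) * (A zero j * (a * det (minor zero j B) + det (minor zero j C)))
        ≈⟨ distrib₂ _ _ _ _ _ ⟩
      a * (sgn (toℕ j) * (A zero j * det (minor zero j B))) + sgn (toℕ j) * (A zero j * det (minor zero j C))
        ≈⟨ +-cong (*-congˡ (*-congˡ (*-congʳ (A≈B zero j j≢q)))) (*-congˡ (*-congʳ (A≈C zero j j≢q))) ⟩
      a * laplaceTerm B j + laplaceTerm C j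
        ∎
      where
      q′ : Fin n
      q′ = punchOut j≢q
      q′↦q : punchIn j q′ ≡ q
      q′↦q = FP.punchIn-punchOut j≢q
      avoids : ∀ v → v ≢ q′ → punchIn j v ≢ q
      avoids v v≢q′ e = v≢q′ (FP.punchIn-injective j v q′ (P.trans e (P.sym q′↦q)))
      minor-linear : det (minor zero j A) ≈ a * det (minor zero j B) + det (minor zero j C)
      minor-linear = det-linearColumn q′ a (minor zero j A) (minor zero j B) (minor zero j C)
        (λ u v v≢q′ → A≈B (suc u) (punchIn j v) (avoids v v≢q′))
        (λ u v v≢q′ → A≈C (suc u) (punchIn j v) (avoids v v≢q′))
        (λ u → P.subst (λ w → A (suc u) w ≈ a * B (suc u) w + C (suc u) w) (P.sym q′↦q) (column (suc u)))

  det-zeroColumn : ∀ {n} (q : Fin n) (A : Matrix n) → (∀ u → A u q ≈ 0#) → det A ≈ 0#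
  det-zeroColumn q A zeroColumn =
    trans (det-linearColumn q (- 1#) A A A (λ _ _ _ → ≈-refl) (λ _ _ _ → ≈-refl)
             (λ u → trans (zeroColumn u) (sym (cancel _))))
          (cancel _)
    where
    cancel : ∀ x → - 1# * x + x ≈ 0#
    cancel = solve 1 (λ x → :- con (+ 1) :* x :+ x := con (+ 0)) ≈-refl

  δ-suc : ∀ {n} (u v : Fin n) → δ (suc u) (suc v) ≈ δ u v
  δ-suc u v with u ≟ v
  ... | yes _ = ≈-refl
  ... | no _  = ≈-refl

  -- After deleting column punchIn q j, column q sits at position survivor q j.
  survivor : ∀ {n} → Fin (N.suc (N.suc n)) → Fin (N.suc n) → Fin (N.suc n)
  survivor           zero    j       = zero
  survivor           (suc q) zero    = q
  survivor {ℕ.suc n} (suc q) (suc j) = suc (survivor q j)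

  punchIn-survivor : ∀ {n} (q : Fin (N.suc (N.suc n))) j → punchIn (punchIn q j) (survivor q j) ≡ q
  punchIn-survivor           zero    j       = refl
  punchIn-survivor           (suc q) zero    = refl
  punchIn-survivor {ℕ.suc n} (suc q) (suc j) = cong suc (punchIn-survivor q j)

  punchIn-survivor-punchIn : ∀ {n} (q : Fin (N.suc (N.suc n))) j (b : Fin n) →
    punchIn (punchIn q j) (punchIn (survivor q j) b) ≡ punchIn q (punchIn j b)
  punchIn-survivor-punchIn           zero    j       b       = refl
  punchIn-survivor-punchIn           (suc q) zero    b       = refl
  punchIn-survivor-punchIn {ℕ.suc n} (suc q) (suc j) zero    = refl
  punchIn-survivor-punchIn {ℕ.suc n} (suc q) (suc j) (suc b) = cong suc (punchIn-survivor-punchIn q j b)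

  sgn-survivor : ∀ {n} (q : Fin (N.suc (N.suc n))) j →
    sgn (toℕ (punchIn q j)) * sgn (toℕ (survivor q j)) ≈ - (sgn (toℕ q) * sgn (toℕ j))
  sgn-survivor           zero    j       = solve 1 (λ s → :- s :* con (+ 1) := :- (con (+ 1) :* s)) ≈-refl _
  sgn-survivor           (suc q) zero    = solve 1 (λ s → con (+ 1) :* s := :- (:- s :* con (+ 1))) ≈-refl _
  sgn-survivor {ℕ.suc n} (suc q) (suc j) = begin
    - sgn (toℕ (punchIn q j)) * - sgn (toℕ (survivor q j))   ≈⟨ neg-*-neg _ _ ⟩
    sgn (toℕ (punchIn q j)) * sgn (toℕ (survivor q j))       ≈⟨ sgn-survivor q j ⟩
    - (sgn (toℕ q) * sgn (toℕ j))                             ≈⟨ -‿cong (sym (neg-*-neg _ _)) ⟩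
    - (- sgn (toℕ q) * - sgn (toℕ j))                         ∎
    where
    neg-*-neg : ∀ x y → - x * - y ≈ x * y
    neg-*-neg = solve 2 (λ x y → :- x :* :- y := x :* y) ≈-refl

  laplaceTerm-unitColumn₀ : ∀ {n} (q : Fin (N.suc n)) (A : Matrix (N.suc n)) → (∀ u → A u q ≈ δ u zero) →
    ∀ j → laplaceTerm A (punchIn q j) ≈ 0#
  laplaceTerm-unitColumn₀ {ℕ.suc n} q A column j =
    trans (*-congˡ (trans (*-congˡ zeroMinor) (zeroʳ _))) (zeroʳ _)
    where
    zeroMinor : det (minor zero (punchIn q j) A) ≈ 0#
    zeroMinor = det-zeroColumn (survivor q j) (minor zero (punchIn q j) A)
      (λ u → trans (reflexive (cong (A (suc u)) (punchIn-survivor q j))) (column (suc u)))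

  det-unitColumn : ∀ {n} (p q : Fin (N.suc n)) (A : Matrix (N.suc n)) → (∀ u → A u q ≈ δ u p) →
    det A ≈ sgn (toℕ p) * sgn (toℕ q) * det (minor p q A)
  det-unitColumn zero q A column = begin
    det A                                                              ≈⟨ sumF-punchIn (laplaceTerm A) q ⟩
    laplaceTerm A q + sumF (λ j → laplaceTerm A (punchIn q j))         ≈⟨ +-cong (*-congˡ (*-congʳ (column zero)))
                                                                                 (sumF-zero _ (laplaceTerm-unitColumn₀ q A column)) ⟩
    sgn (toℕ q) * (1# * det (minor zero q A)) + 0#                     ≈⟨ tidy _ _ ⟩
    1# * sgn (toℕ q) * det (minor zero q A)                            ∎
    where
    tidy : ∀ s d → s * (1# * d) + 0# ≈ 1# * s * d
    tidy = solve 2 (λ s d → s :* (con (+ 1) :* d) :+ con (+ 0) := con (+ 1) :* s :* d) ≈-refl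
  det-unitColumn {ℕ.suc n} (suc p) q A column = begin
    det A                                                              ≈⟨ sumF-punchIn (laplaceTerm A) q ⟩
    laplaceTerm A q + sumF (λ j → laplaceTerm A (punchIn q j))         ≈⟨ +-congʳ (trans (*-congˡ (trans (*-congʳ (column zero)) (zeroˡ _))) (zeroʳ _)) ⟩
    0# + sumF (λ j → laplaceTerm A (punchIn q j))                      ≈⟨ +-identityˡ _ ⟩
    sumF (λ j → laplaceTerm A (punchIn q j))                           ≈⟨ sumF-cong term ⟩
    sumF (λ j → (- sgn (toℕ p) * sgn (toℕ q)) * laplaceTerm M j)       ≈⟨ sumF-*ˡ _ (laplaceTerm M) ⟩
    - sgn (toℕ p) * sgn (toℕ q) * det M                                ∎
    where
    M : Matrix (N.suc n)
    M = minor (suc p) q A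
    rearrange₁ : ∀ s₁ s₂ s x d → s₁ * (x * (s * s₂ * d)) ≈ (s₁ * s₂) * (s * (x * d))
    rearrange₁ = solve 5 (λ s₁ s₂ s x d → s₁ :* (x :* (s :* s₂ :* d)) := (s₁ :* s₂) :* (s :* (x :* d))) ≈-refl
    rearrange₂ : ∀ s₁ s₂ s x d → - (s₁ * s₂) * (s * (x * d)) ≈ (- s * s₁) * (s₂ * (x * d))
    rearrange₂ = solve 5 (λ s₁ s₂ s x d → :- (s₁ :* s₂) :* (s :* (x :* d)) := (:- s :* s₁) :* (s₂ :* (x :* d))) ≈-refl
    term : ∀ j → laplaceTerm A (punchIn q j) ≈ (- sgn (toℕ p) * sgn (toℕ q)) * laplaceTerm M j
    term j = begin
      sgn (toℕ (punchIn q j)) * (A zero (punchIn q j) * det (minor zero (punchIn q j) A))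
        ≈⟨ *-congˡ (*-congˡ expand) ⟩
      sgn (toℕ (punchIn q j)) * (A zero (punchIn q j) * (sgn (toℕ p) * sgn (toℕ (survivor q j)) * det (minor zero j M)))
        ≈⟨ rearrange₁ _ _ _ _ _ ⟩
      (sgn (toℕ (punchIn q j)) * sgn (toℕ (survivor q j))) * (sgn (toℕ p) * (A zero (punchIn q j) * det (minor zero j M)))
        ≈⟨ *-congʳ (sgn-survivor q j) ⟩
      - (sgn (toℕ q) * sgn (toℕ j)) * (sgn (toℕ p) * (A zero (punchIn q j) * det (minor zero j M)))
        ≈⟨ rearrange₂ _ _ _ _ _ ⟩
      (- sgn (toℕ p) * sgn (toℕ q)) * laplaceTerm M j
        ∎
      where
      expand : det (minor zero (punchIn q j) A) ≈ sgn (toℕ p) * sgn (toℕ (survivor q j)) * det (minor zero j M)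
      expand = trans
        (det-unitColumn p (survivor q j) (minor zero (punchIn q j) A)
          (λ u → trans (reflexive (cong (A (suc u)) (punchIn-survivor q j))) (trans (column (suc u)) (δ-suc u p))))
        (*-congˡ (det-cong (λ a b → reflexive (cong (A (suc (punchIn p a))) (punchIn-survivor-punchIn q j b)))))

  data AdjacentView {n} (c : Fin (N.suc n)) : Fin (N.suc (N.suc n)) → Set where
    left    : AdjacentView c (inject₁ c)
    right   : AdjacentView c (suc c)
    outside : ∀ {j} (c′ : Fin n) → punchIn j (inject₁ c′) ≡ inject₁ c → punchIn j (suc c′) ≡ suc c → AdjacentView c j

  adjacentView : ∀ {n} (c : Fin (N.suc n)) j → AdjacentView c j
  adjacentView           zero    zero             = left
  adjacentView           zero    (suc zero)       = right
  adjacentView {ℕ.suc n} zero    (suc (suc j))    = outside zero refl refl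
  adjacentView           (suc c) zero             = outside c refl refl
  adjacentView {ℕ.suc n} (suc c) (suc j) with adjacentView c j
  ... | left                  = left
  ... | right                 = right
  ... | outside c′ e₁ e₂      = outside (suc c′) (cong suc e₁) (cong suc e₂)

  punchIn-adjacent : ∀ {n} (c : Fin (N.suc n)) b →
    punchIn (inject₁ c) b ≡ punchIn (suc c) b ⊎ (punchIn (inject₁ c) b ≡ suc c × punchIn (suc c) b ≡ inject₁ c)
  punchIn-adjacent           zero    zero    = inj₂ (refl , refl)
  punchIn-adjacent           zero    (suc b) = inj₁ refl
  punchIn-adjacent           (suc c) zero    = inj₁ refl
  punchIn-adjacent {ℕ.suc n} (suc c) (suc b) with punchIn-adjacent c b
  ... | inj₁ e           = inj₁ (cong suc e)
  ... | inj₂ (e₁ , e₂)   = inj₂ (cong suc e₁ , cong suc e₂)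

  det-adjacentEqualColumns : ∀ {n} (c : Fin n) (A : Matrix (N.suc n)) →
    (∀ u → A u (inject₁ c) ≈ A u (suc c)) → det A ≈ 0#
  det-adjacentEqualColumns {ℕ.suc n} c A equal = sumF-adjacentPair c (laplaceTerm A) others pair
    where
    others : ∀ j → j ≢ inject₁ c → j ≢ suc c → laplaceTerm A j ≈ 0#
    others j j≢l j≢r with adjacentView c j
    ... | left               = ⊥-elim (j≢l refl)
    ... | right              = ⊥-elim (j≢r refl)
    ... | outside c′ e₁ e₂   = trans (*-congˡ (trans (*-congˡ minorVanishes) (zeroʳ _))) (zeroʳ _)
      where
      minorVanishes : det (minor zero j A) ≈ 0#
      minorVanishes = det-adjacentEqualColumns c′ (minor zero j A)
        (λ u → trans (reflexive (cong (A (suc u)) e₁)) (trans (equal (suc u)) (reflexive (cong (A (suc u)) (P.sym e₂)))))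
    sameMinor : ∀ a b → minor zero (suc c) A a b ≈ minor zero (inject₁ c) A a b
    sameMinor a b with punchIn-adjacent c b
    ... | inj₁ e           = reflexive (cong (A (suc a)) (P.sym e))
    ... | inj₂ (e₁ , e₂)   = trans (reflexive (cong (A (suc a)) e₂))
                                   (trans (equal (suc a)) (reflexive (cong (A (suc a)) (P.sym e₁))))
    cancel : ∀ s x d → s * (x * d) + - s * (x * d) ≈ 0#
    cancel = solve 3 (λ s x d → s :* (x :* d) :+ :- s :* (x :* d) := con (+ 0)) ≈-refl
    pair : laplaceTerm A (inject₁ c) + laplaceTerm A (suc c) ≈ 0#
    pair = begin
      laplaceTerm A (inject₁ c) + laplaceTerm A (suc c)
        ≈⟨ +-cong (reflexive (cong (λ i → sgn i * (A zero (inject₁ c) * det (minor zero (inject₁ c) A))) (FP.toℕ-inject₁ c)))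
                  (*-congˡ (*-cong (sym (equal zero)) (det-cong sameMinor))) ⟩
      sgn (toℕ c) * (A zero (inject₁ c) * det (minor zero (inject₁ c) A))
        + - sgn (toℕ c) * (A zero (inject₁ c) * det (minor zero (inject₁ c) A))
        ≈⟨ cancel _ _ _ ⟩
      0#
        ∎

module Recurrences {c ℓ} (R : CommutativeRing c ℓ) where
  open CommutativeRing R renaming (refl to ≈-refl)
  open RingDefs R
  open IntegerCoefficients R using (solve; _:=_; _:+_; _:*_; con)
  open SetoidReasoning setoid

  linearRecurrence : ∀ t (e z : ℕ → Carrier) →
    (∀ a → e (ℕ.suc a) ≈ t * e a + z a) → (∀ a → z (ℕ.suc a) ≈ t * z a) →
    ∀ a → e a ≈ pow t a * e 0 + ι a * pow t (a N.∸ 1) * z 0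
  linearRecurrence t e z eStep zStep = solution
    where
    geometric : ∀ a → z a ≈ pow t a * z 0
    geometric ℕ.zero    = sym (*-identityˡ _)
    geometric (ℕ.suc a) = trans (zStep a) (trans (*-congˡ (geometric a)) (sym (*-assoc _ _ _)))

    absorb : ∀ a → t * (ι a * pow t (a N.∸ 1)) ≈ ι a * pow t a
    absorb ℕ.zero    = trans (*-congˡ (zeroˡ _)) (trans (zeroʳ _) (sym (zeroˡ _)))
    absorb (ℕ.suc a) = solve 3 (λ t i p → t :* (i :* p) := i :* (t :* p)) ≈-refl t (ι (ℕ.suc a)) (pow t a)

    regroup : ∀ t p q e₀ z₀ → t * (p * e₀ + q * z₀) + p * z₀ ≈ (t * p) * e₀ + (t * q + p) * z₀
    regroup = solve 5 (λ t p q e₀ z₀ → t :* (p :* e₀ :+ q :* z₀) :+ p :* z₀ := (t :* p) :* e₀ :+ (t :* q :+ p) :* z₀) ≈-refl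

    collect : ∀ i p → i * p + p ≈ (1# + i) * p
    collect = solve 2 (λ i p → i :* p :+ p := (con (+ 1) :+ i) :* p) ≈-refl

    solution : ∀ a → e a ≈ pow t a * e 0 + ι a * pow t (a N.∸ 1) * z 0
    solution ℕ.zero    = sym (trans (+-cong (*-identityˡ _) (trans (*-congʳ (zeroˡ _)) (zeroˡ _))) (+-identityʳ _))
    solution (ℕ.suc a) = begin
      e (ℕ.suc a)                                                     ≈⟨ eStep a ⟩
      t * e a + z a                                                   ≈⟨ +-cong (*-congˡ (solution a)) (geometric a) ⟩
      t * (pow t a * e 0 + ι a * pow t (a N.∸ 1) * z 0) + pow t a * z 0 ≈⟨ regroup _ _ _ _ _ ⟩
      (t * pow t a) * e 0 + (t * (ι a * pow t (a N.∸ 1)) + pow t a) * z 0 ≈⟨ +-congˡ (*-congʳ (+-congʳ (absorb a))) ⟩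
      pow t (ℕ.suc a) * e 0 + (ι a * pow t a + pow t a) * z 0          ≈⟨ +-congˡ (*-congʳ (collect _ _)) ⟩
      pow t (ℕ.suc a) * e 0 + ι (ℕ.suc a) * pow t a * z 0              ∎

module LabelledMatrices {c ℓ} (R : CommutativeRing c ℓ) {L : Set}
                        (offDiagonal : L → L → CommutativeRing.Carrier R) where
  open CommutativeRing R renaming (refl to ≈-refl) hiding (zero)
  open RingDefs R
  open Determinants R
  open Recurrences R
  open IntegerCoefficients R using (solve; _:=_; _:+_; _:*_; :-_; con)
  open SetoidReasoning setoid

  Vertex : Set c
  Vertex = L × Carrier

  labelled : ∀ {n} → Vec Vertex n → Matrix n
  labelled xs u v = δ u v * proj₂ (lookup xs u) + offDiagonal (proj₁ (lookup xs u)) (proj₁ (lookup xs v))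

  detL : ∀ {n} → Vec Vertex n → Carrier
  detL xs = det (labelled xs)

  δ-diag : ∀ {n} (u : Fin n) → δ u u ≈ 1#
  δ-diag u with u ≟ u
  ... | yes _   = ≈-refl
  ... | no u≢u  = ⊥-elim (u≢u refl)

  δ-off : ∀ {n} (u v : Fin n) → u ≢ v → δ u v ≈ 0#
  δ-off u v u≢v with u ≟ v
  ... | yes u≡v = ⊥-elim (u≢v u≡v)
  ... | no _    = ≈-refl

  δ-punchIn : ∀ {n} (p : Fin (N.suc n)) (a b : Fin n) → δ (punchIn p a) (punchIn p b) ≈ δ a b
  δ-punchIn p a b with a ≟ b
  ... | yes refl = δ-diag _
  ... | no a≢b   = δ-off _ _ (λ e → a≢b (FP.punchIn-injective p a b e))

  sgn-square : ∀ i → sgn i * sgn i ≈ 1#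
  sgn-square ℕ.zero    = *-identityˡ _
  sgn-square (ℕ.suc i) = trans (solve 1 (λ s → :- s :* :- s := s :* s) ≈-refl _) (sgn-square i)

  withColumn : ∀ {n} → Matrix n → Fin n → (Fin n → Carrier) → Matrix n
  withColumn A q f u v with v ≟ q
  ... | yes _ = f u
  ... | no _  = A u v

  withColumn-at : ∀ {n} (A : Matrix n) q f u → withColumn A q f u q ≈ f u
  withColumn-at A q f u with q ≟ q
  ... | yes _  = ≈-refl
  ... | no q≢q = ⊥-elim (q≢q refl)

  withColumn-off : ∀ {n} (A : Matrix n) q f u v → v ≢ q → withColumn A q f u v ≈ A u v
  withColumn-off A q f u v v≢q with v ≟ q
  ... | yes v≡q = ⊥-elim (v≢q v≡q)
  ... | no _    = ≈-refl

  lookup-removeAt : ∀ {n} (xs : Vec Vertex (N.suc n)) p a → lookup (removeAt xs p) a ≡ lookup xs (punchIn p a)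
  lookup-removeAt xs p a =
    P.trans (cong (lookup (removeAt xs p)) (P.sym (FP.punchOut-punchIn p)))
            (removeAt-punchOut xs (λ e → FP.punchInᵢ≢i p a (P.sym e)))

  det-deleteUnitColumn : ∀ {n} (xs : Vec Vertex (N.suc n)) p →
    det (withColumn (labelled xs) p (λ u → δ u p)) ≈ detL (removeAt xs p)
  det-deleteUnitColumn {n} xs p = begin
    det A′                                                  ≈⟨ det-unitColumn p p A′ (withColumn-at (labelled xs) p (λ u → δ u p)) ⟩
    sgn (toℕ p) * sgn (toℕ p) * det (minor p p A′)          ≈⟨ *-cong (sgn-square (toℕ p)) (det-cong entry) ⟩
    1# * detL (removeAt xs p)                               ≈⟨ *-identityˡ _ ⟩
    detL (removeAt xs p)                                    ∎
    where
    A′ : Matrix (N.suc n)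
    A′ = withColumn (labelled xs) p (λ u → δ u p)
    entry : ∀ a b → minor p p A′ a b ≈ labelled (removeAt xs p) a b
    entry a b rewrite lookup-removeAt xs p a | lookup-removeAt xs p b =
      trans (withColumn-off (labelled xs) p _ (punchIn p a) (punchIn p b) (FP.punchInᵢ≢i p b))
            (+-congʳ (*-congʳ (δ-punchIn p a b)))

  det-peel : ∀ {n} (xs : Vec Vertex (N.suc n)) p →
    detL xs ≈ proj₂ (lookup xs p) * detL (removeAt xs p) + detL (xs [ p ]≔ (proj₁ (lookup xs p) , 0#))
  det-peel {n} xs p = begin
    det A                ≈⟨ det-linearColumn p t A B C (λ u v v≢p → sym (withColumn-off A p _ u v v≢p)) A≈C column ⟩
    t * det B + det C    ≈⟨ +-congʳ (*-congˡ (det-deleteUnitColumn xs p)) ⟩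
    t * detL (removeAt xs p) + det C ∎
    where
    l : L
    l = proj₁ (lookup xs p)
    t : Carrier
    t = proj₂ (lookup xs p)
    A B C : Matrix (N.suc n)
    A = labelled xs
    B = withColumn A p (λ u → δ u p)
    C = labelled (xs [ p ]≔ (l , 0#))
    A≈C : ∀ u v → v ≢ p → A u v ≈ C u v
    A≈C u v v≢p with toSum (u ≟ p)
    ... | inj₁ refl rewrite lookup∘update p xs (l , 0#) | lookup∘update′ v≢p xs (l , 0#) =
      +-congʳ (trans (*-congʳ p≉v) (trans (zeroˡ _) (sym (trans (*-congʳ p≉v) (zeroˡ _)))))
      where p≉v = δ-off p v (λ e → v≢p (P.sym e))
    ... | inj₂ u≢p rewrite lookup∘update′ u≢p xs (l , 0#) | lookup∘update′ v≢p xs (l , 0#) = ≈-refl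
    column : ∀ u → A u p ≈ t * B u p + C u p
    column u with toSum (u ≟ p)
    ... | inj₁ refl rewrite lookup∘update p xs (l , 0#) = begin
      δ p p * t + offDiagonal l l               ≈⟨ +-congʳ (*-congʳ (δ-diag p)) ⟩
      1# * t + offDiagonal l l                  ≈⟨ solve 2 (λ t o → con (+ 1) :* t :+ o := t :* con (+ 1) :+ (con (+ 1) :* con (+ 0) :+ o)) ≈-refl _ _ ⟩
      t * 1# + (1# * 0# + offDiagonal l l)      ≈⟨ sym (+-cong (*-congˡ (trans (withColumn-at A p _ p) (δ-diag p))) (+-congʳ (*-congʳ (δ-diag p)))) ⟩
      t * B p p + (δ p p * 0# + offDiagonal l l) ∎
    ... | inj₂ u≢p rewrite lookup∘update′ u≢p xs (l , 0#) | lookup∘update p xs (l , 0#) = begin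
      δ u p * tᵤ + offDiagonal lᵤ l             ≈⟨ +-congʳ (*-congʳ (δ-off u p u≢p)) ⟩
      0# * tᵤ + offDiagonal lᵤ l                ≈⟨ solve 3 (λ t tᵤ o → con (+ 0) :* tᵤ :+ o := t :* con (+ 0) :+ (con (+ 0) :* tᵤ :+ o)) ≈-refl t _ _ ⟩
      t * 0# + (0# * tᵤ + offDiagonal lᵤ l)     ≈⟨ sym (+-cong (*-congˡ (trans (withColumn-at A p _ u) (δ-off u p u≢p))) (+-congʳ (*-congʳ (δ-off u p u≢p)))) ⟩
      t * B u p + (δ u p * tᵤ + offDiagonal lᵤ l) ∎
      where
      lᵤ : L
      lᵤ = proj₁ (lookup xs u)
      tᵤ : Carrier
      tᵤ = proj₂ (lookup xs u)

  det-merge : ∀ {n} (xs : Vec Vertex (N.suc (N.suc n))) (c : Fin (N.suc n)) →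
    proj₁ (lookup xs (inject₁ c)) ≡ proj₁ (lookup xs (suc c)) → proj₂ (lookup xs (inject₁ c)) ≡ 0# →
    detL xs ≈ proj₂ (lookup xs (suc c)) * detL (removeAt xs (suc c))
  det-merge {n} xs c sameLabel zeroDiagonal = begin
    det A                          ≈⟨ det-linearColumn q t A B C (λ u v v≢q → sym (withColumn-off A q _ u v v≢q))
                                                                 (λ u v v≢q → sym (withColumn-off A q _ u v v≢q)) column ⟩
    t * det B + det C              ≈⟨ +-cong (*-congˡ (det-deleteUnitColumn xs q)) (det-adjacentEqualColumns c C equal) ⟩
    t * detL (removeAt xs q) + 0#  ≈⟨ +-identityʳ _ ⟩
    t * detL (removeAt xs q)       ∎
    where
    q i : Fin (N.suc (N.suc n))
    q = suc c
    i = inject₁ c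
    t : Carrier
    t = proj₂ (lookup xs q)
    A B C : Matrix (N.suc (N.suc n))
    A = labelled xs
    B = withColumn A q (λ u → δ u q)
    C = withColumn A q (λ u → A u i)
    i≢q : i ≢ q
    i≢q e = NP.1+n≢n (P.sym (P.trans (P.sym (FP.toℕ-inject₁ c)) (cong toℕ e)))
    equal : ∀ u → C u i ≈ C u q
    equal u = trans (withColumn-off A q _ u i i≢q) (sym (withColumn-at A q _ u))
    diagonal-q : ∀ u → δ u q * proj₂ (lookup xs u) ≈ t * δ u q
    diagonal-q u with toSum (u ≟ q)
    ... | inj₁ refl = *-comm _ _
    ... | inj₂ u≢q  = trans (*-congʳ (δ-off u q u≢q)) (trans (zeroˡ _) (sym (trans (*-congˡ (δ-off u q u≢q)) (zeroʳ _))))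
    diagonal-i : ∀ u → δ u i * proj₂ (lookup xs u) ≈ 0#
    diagonal-i u with toSum (u ≟ i)
    ... | inj₁ refl = trans (*-congˡ (reflexive zeroDiagonal)) (zeroʳ _)
    ... | inj₂ u≢i  = trans (*-congʳ (δ-off u i u≢i)) (zeroˡ _)
    column : ∀ u → A u q ≈ t * B u q + C u q
    column u = begin
      δ u q * proj₂ (lookup xs u) + offDiagonal (proj₁ (lookup xs u)) (proj₁ (lookup xs q))
        ≈⟨ +-cong (diagonal-q u) (reflexive (cong (offDiagonal (proj₁ (lookup xs u))) (P.sym sameLabel))) ⟩
      t * δ u q + offDiagonal (proj₁ (lookup xs u)) (proj₁ (lookup xs i))
        ≈⟨ +-congˡ (sym (trans (+-congʳ (diagonal-i u)) (+-identityˡ _))) ⟩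
      t * δ u q + A u i
        ≈⟨ sym (+-cong (*-congˡ (withColumn-at A q _ u)) (withColumn-at A q _ u)) ⟩
      t * B u q + C u q
        ∎

  -- det-peel splits off the diagonal value of a block's first vertex; det-merge absorbs
  -- each further vertex of the block into its zeroed predecessor.
  det-block₀ : ∀ l t a {n} (ys : Vec Vertex n) →
    detL (replicate a (l , t) ++ ys) ≈ pow t a * detL ys + ι a * pow t (a N.∸ 1) * detL ((l , 0#) ∷ ys)
  det-block₀ l t a ys = linearRecurrence t
    (λ i → detL (replicate i (l , t) ++ ys))
    (λ i → detL ((l , 0#) ∷ replicate i (l , t) ++ ys))
    (λ i → det-peel ((l , t) ∷ replicate i (l , t) ++ ys) zero)
    (λ i → det-merge ((l , 0#) ∷ (l , t) ∷ replicate i (l , t) ++ ys) zero refl refl) a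

  det-block₁ : ∀ x l t a {n} (ys : Vec Vertex n) →
    detL (x ∷ replicate a (l , t) ++ ys) ≈ pow t a * detL (x ∷ ys) + ι a * pow t (a N.∸ 1) * detL (x ∷ (l , 0#) ∷ ys)
  det-block₁ x l t a ys = linearRecurrence t
    (λ i → detL (x ∷ replicate i (l , t) ++ ys))
    (λ i → detL (x ∷ (l , 0#) ∷ replicate i (l , t) ++ ys))
    (λ i → det-peel (x ∷ (l , t) ∷ replicate i (l , t) ++ ys) (suc zero))
    (λ i → det-merge (x ∷ (l , 0#) ∷ (l , t) ∷ replicate i (l , t) ++ ys) (suc zero) refl refl) a

  det-block₂ : ∀ x y l t a {n} (ys : Vec Vertex n) →
    detL (x ∷ y ∷ replicate a (l , t) ++ ys)
      ≈ pow t a * detL (x ∷ y ∷ ys) + ι a * pow t (a N.∸ 1) * detL (x ∷ y ∷ (l , 0#) ∷ ys)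
  det-block₂ x y l t a ys = linearRecurrence t
    (λ i → detL (x ∷ y ∷ replicate i (l , t) ++ ys))
    (λ i → detL (x ∷ y ∷ (l , 0#) ∷ replicate i (l , t) ++ ys))
    (λ i → det-peel (x ∷ y ∷ (l , t) ∷ replicate i (l , t) ++ ys) (suc (suc zero)))
    (λ i → det-merge (x ∷ y ∷ (l , 0#) ∷ (l , t) ∷ replicate i (l , t) ++ ys) (suc (suc zero)) refl refl) a

<ᵇ-true : ∀ {i j} → i < j → (i <ᵇ j) ≡ true
<ᵇ-true i<j = Equivalence.to T-≡ (NP.<⇒<ᵇ i<j)

<ᵇ-false : ∀ {i j} → j ≤ i → (i <ᵇ j) ≡ false
<ᵇ-false {i} {j} j≤i = ¬-not (λ e → NP.<⇒≱ (NP.<ᵇ⇒< i j (Equivalence.from T-≡ e)) j≤i)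

≤ᵇ-true : ∀ {i j} → i ≤ j → (i ≤ᵇ j) ≡ true
≤ᵇ-true i≤j = Equivalence.to T-≡ (NP.≤⇒≤ᵇ i≤j)

≤ᵇ-false : ∀ {i j} → j < i → (i ≤ᵇ j) ≡ false
≤ᵇ-false {i} {j} j<i = ¬-not (λ e → NP.<⇒≱ j<i (NP.≤ᵇ⇒≤ i j (Equivalence.from T-≡ e)))

≡ᵇ-true : ∀ {i j} → i ≡ j → (i ≡ᵇ j) ≡ true
≡ᵇ-true {i} {j} i≡j = Equivalence.to T-≡ (NP.≡⇒≡ᵇ i j i≡j)

≡ᵇ-false : ∀ {i j} → i ≢ j → (i ≡ᵇ j) ≡ false
≡ᵇ-false {i} {j} i≢j = ¬-not (λ e → i≢j (NP.≡ᵇ⇒≡ i j (Equivalence.from T-≡ e)))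

⌊≟⌋≡≡ᵇ : ∀ {n} (u v : Fin n) → ⌊ u ≟ v ⌋ ≡ (toℕ u ≡ᵇ toℕ v)
⌊≟⌋≡≡ᵇ u v with u ≟ v
... | yes refl = P.sym (≡ᵇ-true {toℕ u} refl)
... | no u≢v   = P.sym (≡ᵇ-false (λ e → u≢v (FP.toℕ-injective e)))

≡ᵇ-cong : ∀ {a b c d} → (a ≡ b → c ≡ d) → (c ≡ d → a ≡ b) → (a ≡ᵇ b) ≡ (c ≡ᵇ d)
≡ᵇ-cong {a} {b} f g with a N.≟ b
... | yes a≡b = P.trans (≡ᵇ-true a≡b) (P.sym (≡ᵇ-true (f a≡b)))
... | no a≢b  = P.trans (≡ᵇ-false a≢b) (P.sym (≡ᵇ-false (λ e → a≢b (g e))))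

count : (ℕ → Bool) → ℕ → ℕ
count P ℕ.zero    = 0
count P (ℕ.suc M) = (if P 0 then 1 else 0) N.+ count (λ i → P (ℕ.suc i)) M

countF-toℕ : ∀ M (P : ℕ → Bool) → countF {M} (λ v → P (toℕ v)) ≡ count P M
countF-toℕ ℕ.zero    P = refl
countF-toℕ (ℕ.suc M) P = cong ((if P 0 then 1 else 0) N.+_) (countF-toℕ M (λ i → P (ℕ.suc i)))

countF-cong : ∀ {M} {P Q : Fin M → Bool} → (∀ i → P i ≡ Q i) → countF P ≡ countF Q
countF-cong {ℕ.zero}  P≡Q = refl
countF-cong {ℕ.suc M} P≡Q = cong₂ N._+_ (cong (λ b → if b then 1 else 0) (P≡Q zero)) (countF-cong (λ i → P≡Q (suc i)))

count-+ : ∀ a b (P : ℕ → Bool) → count P (a N.+ b) ≡ count P a N.+ count (λ i → P (a N.+ i)) b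
count-+ ℕ.zero    b P = refl
count-+ (ℕ.suc a) b P = P.trans (cong ((if P 0 then 1 else 0) N.+_) (count-+ a b (λ i → P (ℕ.suc i))))
                                (P.sym (NP.+-assoc (if P 0 then 1 else 0) _ _))

count-constant : ∀ a (P : ℕ → Bool) {b} → (∀ i → i < a → P i ≡ b) → count P a ≡ (if b then a else 0)
count-constant ℕ.zero    P {false} _      = refl
count-constant ℕ.zero    P {true}  _      = refl
count-constant (ℕ.suc a) P {b}     P≡b
  rewrite P≡b 0 (s≤s z≤n)
  with b | count-constant a (λ i → P (ℕ.suc i)) (λ i i<a → P≡b (ℕ.suc i) (s≤s i<a))
... | false | rest = rest
... | true  | rest = cong ℕ.suc rest

count-remove : ∀ M (P : ℕ → Bool) j → j < M →
  count (λ i → not (j ≡ᵇ i) ∧ P i) M N.+ (if P j then 1 else 0) ≡ count P M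
count-remove (ℕ.suc M) P ℕ.zero    _         = NP.+-comm (count (λ i → P (ℕ.suc i)) M) (if P 0 then 1 else 0)
count-remove (ℕ.suc M) P (ℕ.suc j) (s≤s j<M) =
  P.trans (NP.+-assoc (if P 0 then 1 else 0) _ (if P (ℕ.suc j) then 1 else 0))
          (cong ((if P 0 then 1 else 0) N.+_) (count-remove M (λ i → P (ℕ.suc i)) j j<M))

liftAdj-complete : ∀ M (b b′ : Bool) x y → (b ≡ true → x < M) → (b′ ≡ true → y < M) →
  liftAdj (complete M) (toFinM M (if b then just x else nothing)) (toFinM M (if b′ then just y else nothing))
    ≡ not (x ≡ᵇ y) ∧ (b ∧ b′)
liftAdj-complete M true b′ x y x<M y<M with x <? M
... | no x≮M = ⊥-elim (x≮M (x<M refl))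
... | yes x<M′ with b′
...   | false = P.sym (∧-zeroʳ _)
...   | true with y <? M
...     | no y≮M  = ⊥-elim (y≮M (y<M refl))
...     | yes y<M′ = P.trans (cong not (P.trans (⌊≟⌋≡≡ᵇ (fromℕ< x<M′) (fromℕ< y<M′))
                                                (cong₂ _≡ᵇ_ (FP.toℕ-fromℕ< x<M′) (FP.toℕ-fromℕ< y<M′))))
                             (P.sym (∧-identityʳ _))
liftAdj-complete M false b′ x y _ _ = P.sym (∧-zeroʳ _)

data Block : Set where
  shared onlyKm onlyKn : Block

inKm inKn : Block → Bool
inKm shared = true
inKm onlyKm = true
inKm onlyKn = false
inKn shared = true
inKn onlyKm = false
inKn onlyKn = true

-- two distinct vertices of the coalescence are adjacent iff they lie in a common clique
adjacentBlocks : Block → Block → Bool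
adjacentBlocks b b′ = (inKm b ∧ inKm b′) ∨ (inKn b ∧ inKn b′)

module Coalescence (m n k : ℕ) (k≤m : k ≤ m) (k≤n : k ≤ n) where

  order : ℕ
  order = m N.+ n N.∸ k

  graph : Graph order
  graph = coalesce (complete m) (complete n) k

  block : ℕ → Block
  block j = if j <ᵇ k then shared else (if j <ᵇ m then onlyKm else onlyKn)

  size : Block → ℕ
  size shared = order
  size onlyKm = m
  size onlyKn = n

  data Region (j : ℕ) : Set where
    sharedʳ : j < k → Region j
    onlyKmʳ : k ≤ j → j < m → Region j
    onlyKnʳ : m ≤ j → Region j

  region : ∀ j → Region j
  region j with j <? k
  ... | yes j<k = sharedʳ j<k
  ... | no j≮k with j <? m
  ...   | yes j<m = onlyKmʳ (NP.≮⇒≥ j≮k) j<m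
  ...   | no j≮m  = onlyKnʳ (NP.≮⇒≥ j≮m)

  block-shared : ∀ {j} → j < k → block j ≡ shared
  block-shared j<k rewrite <ᵇ-true j<k = refl

  block-onlyKm : ∀ {j} → k ≤ j → j < m → block j ≡ onlyKm
  block-onlyKm k≤j j<m rewrite <ᵇ-false k≤j | <ᵇ-true j<m = refl

  block-onlyKn : ∀ {j} → m ≤ j → block j ≡ onlyKn
  block-onlyKn m≤j rewrite <ᵇ-false (NP.≤-trans k≤m m≤j) | <ᵇ-false m≤j = refl

  positionKn : ℕ → ℕ
  positionKn j = if j <ᵇ k then j else j N.∸ m N.+ k

  gIdx≡ : ∀ j → gIdx m j ≡ (if inKm (block j) then just j else nothing)
  gIdx≡ j with region j
  ... | sharedʳ j<k      rewrite block-shared j<k      | <ᵇ-true (NP.<-≤-trans j<k k≤m) = refl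
  ... | onlyKmʳ k≤j j<m  rewrite block-onlyKm k≤j j<m  | <ᵇ-true j<m = refl
  ... | onlyKnʳ m≤j      rewrite block-onlyKn m≤j      | <ᵇ-false m≤j = refl

  hIdx≡ : ∀ j → hIdx k m j ≡ (if inKn (block j) then just (positionKn j) else nothing)
  hIdx≡ j with region j
  ... | sharedʳ j<k      rewrite block-shared j<k      | <ᵇ-true j<k = refl
  ... | onlyKmʳ k≤j j<m  rewrite block-onlyKm k≤j j<m  | <ᵇ-false k≤j | ≤ᵇ-false j<m = refl
  ... | onlyKnʳ m≤j      rewrite block-onlyKn m≤j      | <ᵇ-false (NP.≤-trans k≤m m≤j) | ≤ᵇ-true m≤j = refl

  inKm-bound : ∀ j → inKm (block j) ≡ true → j < m
  inKm-bound j with region j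
  ... | sharedʳ j<k     = λ _ → NP.<-≤-trans j<k k≤m
  ... | onlyKmʳ _ j<m   = λ _ → j<m
  ... | onlyKnʳ m≤j     rewrite block-onlyKn m≤j = λ ()

  order∸m : order N.∸ m ≡ n N.∸ k
  order∸m = P.trans (cong (N._∸ m) (NP.+-∸-assoc m k≤n)) (NP.m+n∸m≡n m (n N.∸ k))

  positionKn-bound : ∀ j → j < order → inKn (block j) ≡ true → positionKn j < n
  positionKn-bound j j<order with region j
  ... | sharedʳ j<k     rewrite <ᵇ-true j<k = λ _ → NP.<-≤-trans j<k k≤n
  ... | onlyKmʳ k≤j j<m rewrite block-onlyKm k≤j j<m = λ ()
  ... | onlyKnʳ m≤j     rewrite <ᵇ-false (NP.≤-trans k≤m m≤j) = λ _ →
    P.subst (j N.∸ m N.+ k <_) (NP.m∸n+n≡m k≤n)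
            (NP.+-monoˡ-< k (P.subst (j N.∸ m <_) order∸m (NP.∸-monoˡ-< j<order m≤j)))

  positionKn-≡ᵇ : ∀ j j′ → inKn (block j) ≡ true → inKn (block j′) ≡ true →
    (positionKn j ≡ᵇ positionKn j′) ≡ (j ≡ᵇ j′)
  positionKn-≡ᵇ j j′ with region j | region j′
  ... | onlyKmʳ k≤j j<m | _ rewrite block-onlyKm k≤j j<m = λ ()
  ... | sharedʳ _ | onlyKmʳ k≤j′ j′<m rewrite block-onlyKm k≤j′ j′<m = λ _ ()
  ... | onlyKnʳ _ | onlyKmʳ k≤j′ j′<m rewrite block-onlyKm k≤j′ j′<m = λ _ ()
  ... | sharedʳ j<k | sharedʳ j′<k rewrite <ᵇ-true j<k | <ᵇ-true j′<k = λ _ _ → refl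
  ... | sharedʳ j<k | onlyKnʳ m≤j′ rewrite <ᵇ-true j<k | <ᵇ-false (NP.≤-trans k≤m m≤j′) = λ _ _ →
    P.trans (≡ᵇ-false (NP.<⇒≢ (NP.<-≤-trans j<k (NP.m≤n+m k (j′ N.∸ m)))))
            (P.sym (≡ᵇ-false (NP.<⇒≢ (NP.<-≤-trans j<k (NP.≤-trans k≤m m≤j′)))))
  ... | onlyKnʳ m≤j | sharedʳ j′<k rewrite <ᵇ-false (NP.≤-trans k≤m m≤j) | <ᵇ-true j′<k = λ _ _ →
    P.trans (≡ᵇ-false (NP.>⇒≢ (NP.<-≤-trans j′<k (NP.m≤n+m k (j N.∸ m)))))
            (P.sym (≡ᵇ-false (NP.>⇒≢ (NP.<-≤-trans j′<k (NP.≤-trans k≤m m≤j)))))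
  ... | onlyKnʳ m≤j | onlyKnʳ m≤j′ rewrite <ᵇ-false (NP.≤-trans k≤m m≤j) | <ᵇ-false (NP.≤-trans k≤m m≤j′) = λ _ _ →
    ≡ᵇ-cong (λ e → P.trans (P.sym (NP.m+[n∸m]≡n m≤j))
                     (P.trans (cong (m N.+_) (NP.+-cancelʳ-≡ k (j N.∸ m) (j′ N.∸ m) e)) (NP.m+[n∸m]≡n m≤j′)))
            (λ e → cong (λ z → z N.∸ m N.+ k) e)

  adjacencyKm : ∀ j j′ → liftAdj (complete m) (toFinM m (gIdx m j)) (toFinM m (gIdx m j′))
                           ≡ not (j ≡ᵇ j′) ∧ (inKm (block j) ∧ inKm (block j′))
  adjacencyKm j j′ rewrite gIdx≡ j | gIdx≡ j′ = liftAdj-complete m _ _ j j′ (inKm-bound j) (inKm-bound j′)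

  adjacencyKn : ∀ j j′ → j < order → j′ < order →
    liftAdj (complete n) (toFinM n (hIdx k m j)) (toFinM n (hIdx k m j′))
      ≡ not (j ≡ᵇ j′) ∧ (inKn (block j) ∧ inKn (block j′))
  adjacencyKn j j′ j<order j′<order rewrite hIdx≡ j | hIdx≡ j′ =
    P.trans (liftAdj-complete n _ _ _ _ (positionKn-bound j j<order) (positionKn-bound j′ j′<order)) relabel
    where
    relabel : not (positionKn j ≡ᵇ positionKn j′) ∧ (inKn (block j) ∧ inKn (block j′))
                ≡ not (j ≡ᵇ j′) ∧ (inKn (block j) ∧ inKn (block j′))
    relabel with inKn (block j) in e | inKn (block j′) in e′
    ... | true  | true  = cong (λ z → not z ∧ true) (positionKn-≡ᵇ j j′ e e′)
    ... | true  | false = P.trans (∧-zeroʳ _) (P.sym (∧-zeroʳ _))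
    ... | false | _     = P.trans (∧-zeroʳ _) (P.sym (∧-zeroʳ _))

  adjacency : ∀ (u v : Fin order) → graph u v ≡ not (toℕ u ≡ᵇ toℕ v) ∧ adjacentBlocks (block (toℕ u)) (block (toℕ v))
  adjacency u v = P.trans (cong₂ _∨_ (adjacencyKm (toℕ u) (toℕ v)) (adjacencyKn (toℕ u) (toℕ v) (FP.toℕ<n u) (FP.toℕ<n v)))
                          (P.sym (∧-distribˡ-∨ (not (toℕ u ≡ᵇ toℕ v)) _ _))

  adjacentBlocks-refl : ∀ b → adjacentBlocks b b ≡ true
  adjacentBlocks-refl shared = refl
  adjacentBlocks-refl onlyKm = refl
  adjacentBlocks-refl onlyKn = refl

  order≡ : order ≡ k N.+ ((m N.∸ k) N.+ (n N.∸ k))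
  order≡ = P.trans (NP.+-∸-assoc m k≤n)
                   (P.trans (cong (N._+ (n N.∸ k)) (P.sym (NP.m+[n∸m]≡n k≤m))) (NP.+-assoc k (m N.∸ k) (n N.∸ k)))

  count-adjacent : ∀ b → count (λ i → adjacentBlocks b (block i)) order ≡ size b
  count-adjacent b = begin
    count A order
      ≡⟨ cong (count A) order≡ ⟩
    count A (k N.+ (q N.+ r))
      ≡⟨ P.trans (count-+ k (q N.+ r) A) (cong (count A k N.+_) (count-+ q r (λ i → A (k N.+ i)))) ⟩
    count A k N.+ (count (λ i → A (k N.+ i)) q N.+ count (λ i → A (k N.+ (q N.+ i))) r)
      ≡⟨ cong₂ N._+_ (count-constant k A inShared)
                     (cong₂ N._+_ (count-constant q _ inOnlyKm) (count-constant r _ inOnlyKn)) ⟩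
    (if adjacentBlocks b shared then k else 0)
      N.+ ((if adjacentBlocks b onlyKm then q else 0) N.+ (if adjacentBlocks b onlyKn then r else 0))
      ≡⟨ total b ⟩
    size b
      ∎
    where
    open P.≡-Reasoning
    A : ℕ → Bool
    A i = adjacentBlocks b (block i)
    q r : ℕ
    q = m N.∸ k
    r = n N.∸ k
    inShared : ∀ i → i < k → A i ≡ adjacentBlocks b shared
    inShared i i<k = cong (adjacentBlocks b) (block-shared i<k)
    inOnlyKm : ∀ i → i < q → A (k N.+ i) ≡ adjacentBlocks b onlyKm
    inOnlyKm i i<q = cong (adjacentBlocks b)
      (block-onlyKm (NP.m≤m+n k i) (P.subst (k N.+ i <_) (NP.m+[n∸m]≡n k≤m) (NP.+-monoʳ-< k i<q)))
    inOnlyKn : ∀ i → i < r → A (k N.+ (q N.+ i)) ≡ adjacentBlocks b onlyKn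
    inOnlyKn i _ = cong (adjacentBlocks b)
      (block-onlyKn (P.subst (_≤ k N.+ (q N.+ i)) (NP.m+[n∸m]≡n k≤m)
                             (P.subst (k N.+ q ≤_) (NP.+-assoc k q i) (NP.m≤m+n (k N.+ q) i))))
    total : ∀ b → (if adjacentBlocks b shared then k else 0)
                    N.+ ((if adjacentBlocks b onlyKm then q else 0) N.+ (if adjacentBlocks b onlyKn then r else 0))
                  ≡ size b
    total shared = P.sym order≡
    total onlyKm = P.trans (cong (k N.+_) (NP.+-identityʳ q)) (NP.m+[n∸m]≡n k≤m)
    total onlyKn = NP.m+[n∸m]≡n k≤n

  degree-suc : ∀ (u : Fin order) → ℕ.suc (degree graph u) ≡ size (block (toℕ u))
  degree-suc u = begin
    ℕ.suc (degree graph u)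
      ≡⟨ NP.+-comm 1 (degree graph u) ⟩
    degree graph u N.+ 1
      ≡⟨ cong₂ N._+_ (P.trans (countF-cong (adjacency u)) (countF-toℕ order (λ i → not (j ≡ᵇ i) ∧ A i)))
                     (cong (λ z → if z then 1 else 0) (P.sym (adjacentBlocks-refl (block j)))) ⟩
    count (λ i → not (j ≡ᵇ i) ∧ A i) order N.+ (if A j then 1 else 0)
      ≡⟨ count-remove order A j (FP.toℕ<n u) ⟩
    count A order
      ≡⟨ count-adjacent (block j) ⟩
    size (block j)
      ∎
    where
    open P.≡-Reasoning
    j : ℕ
    j = toℕ u
    A : ℕ → Bool
    A i = adjacentBlocks (block j) (block i)

lookup-replicate-++ : ∀ {ℓ} {A : Set ℓ} a (w : A) {n} (ys : Vec A n) (g : ℕ → A) →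
  (∀ i → lookup ys i ≡ g (toℕ i)) → ∀ i → lookup (replicate a w ++ ys) i ≡ (if toℕ i <ᵇ a then w else g (toℕ i N.∸ a))
lookup-replicate-++ ℕ.zero    w ys g ys≡g i       = ys≡g i
lookup-replicate-++ (ℕ.suc a) w ys g ys≡g zero    = refl
lookup-replicate-++ (ℕ.suc a) w ys g ys≡g (suc i) = lookup-replicate-++ a w ys g ys≡g i

if-same : ∀ {ℓ} {A : Set ℓ} b (w : A) → (if b then w else w) ≡ w
if-same true  w = refl
if-same false w = refl

module CharacteristicPolynomial {c ℓ} (R : CommutativeRing c ℓ) where
  open CommutativeRing R renaming (refl to ≈-refl) hiding (zero)
  open RingDefs R
  open IntegerCoefficients R
  open Determinants R using (det-cong)
  open SetoidReasoning setoid

  offDiagonal : Carrier → Block → Block → Carrier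
  offDiagonal β b b′ = if adjacentBlocks b b′ then - β else 0#

  blockFormula : (β PC QC PG QG PH QH : Carrier) → Carrier
  blockFormula β PC QC PG QG PH QH =
    PC * (PG * (PH * 1# + QH * - β) + QG * (PH * - β + QH * (β * β)))
    + QC * (PG * (PH * - β + QH * 0#) + QG * (PH * 0# + QH * (β * (β * β))))

  blockFormulaᴾ : ∀ {v} (β PC QC PG QG PH QH : Polynomial v) → Polynomial v
  blockFormulaᴾ β PC QC PG QG PH QH =
    PC :* (PG :* (PH :* con (+ 1) :+ QH :* :- β) :+ QG :* (PH :* :- β :+ QH :* (β :* β)))
    :+ QC :* (PG :* (PH :* :- β :+ QH :* con (+ 0)) :+ QG :* (PH :* con (+ 0) :+ QH :* (β :* (β :* β))))

  module BlockDeterminants (β : Carrier) where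
    open LabelledMatrices R (offDiagonal β) using (Vertex; detL; det-block₀; det-block₁; det-block₂)

    -- Syntactic copies of det and of a zero-diagonal labelled matrix: evaluating
    -- them reproduces the small determinants below, which the solver then normalises.
    sumᴾ : ∀ {n v} → (Fin n → Polynomial v) → Polynomial v
    sumᴾ {ℕ.zero}  f = con (+ 0)
    sumᴾ {ℕ.suc n} f = f zero :+ sumᴾ (λ i → f (suc i))

    sgnᴾ : ∀ {v} → ℕ → Polynomial v
    sgnᴾ ℕ.zero    = con (+ 1)
    sgnᴾ (ℕ.suc i) = :- sgnᴾ i

    detᴾ : ∀ {n v} → (Fin n → Fin n → Polynomial v) → Polynomial v
    detᴾ {ℕ.zero}  M = con (+ 1)
    detᴾ {ℕ.suc n} M = sumᴾ (λ j → sgnᴾ (toℕ j) :* (M zero j :* detᴾ (λ a b → M (suc a) (punchIn j b))))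

    labelledᴾ : ∀ {n} → Vec Block n → Fin n → Fin n → Polynomial 1
    labelledᴾ bs u v =
      (if ⌊ u ≟ v ⌋ then con (+ 1) else con (+ 0)) :* con (+ 0)
      :+ (if adjacentBlocks (lookup bs u) (lookup bs v) then :- var zero else con (+ 0))

    βᴾ : Polynomial 1
    βᴾ = var zero

    det-shared : detL ((shared , 0#) ∷ []) ≈ - β
    det-shared = prove (β ∷ []) (detᴾ (labelledᴾ (shared ∷ []))) (:- βᴾ) ≈-refl
    det-onlyKm : detL ((onlyKm , 0#) ∷ []) ≈ - β
    det-onlyKm = prove (β ∷ []) (detᴾ (labelledᴾ (onlyKm ∷ []))) (:- βᴾ) ≈-refl
    det-onlyKn : detL ((onlyKn , 0#) ∷ []) ≈ - β
    det-onlyKn = prove (β ∷ []) (detᴾ (labelledᴾ (onlyKn ∷ []))) (:- βᴾ) ≈-refl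
    det-shared-onlyKm : detL ((shared , 0#) ∷ (onlyKm , 0#) ∷ []) ≈ 0#
    det-shared-onlyKm = prove (β ∷ []) (detᴾ (labelledᴾ (shared ∷ onlyKm ∷ []))) (con (+ 0)) ≈-refl
    det-shared-onlyKn : detL ((shared , 0#) ∷ (onlyKn , 0#) ∷ []) ≈ 0#
    det-shared-onlyKn = prove (β ∷ []) (detᴾ (labelledᴾ (shared ∷ onlyKn ∷ []))) (con (+ 0)) ≈-refl
    det-onlyKm-onlyKn : detL ((onlyKm , 0#) ∷ (onlyKn , 0#) ∷ []) ≈ β * β
    det-onlyKm-onlyKn = prove (β ∷ []) (detᴾ (labelledᴾ (onlyKm ∷ onlyKn ∷ []))) (βᴾ :* βᴾ) ≈-refl
    det-all : detL ((shared , 0#) ∷ (onlyKm , 0#) ∷ (onlyKn , 0#) ∷ []) ≈ β * (β * β)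
    det-all = prove (β ∷ []) (detᴾ (labelledᴾ (shared ∷ onlyKm ∷ onlyKn ∷ []))) (βᴾ :* (βᴾ :* βᴾ)) ≈-refl


    det-threeBlocks : ∀ (tC tG tH : Carrier) (a₁ a₂ a₃ : ℕ) →
      detL (replicate a₁ (shared , tC) ++ replicate a₂ (onlyKm , tG) ++ replicate a₃ (onlyKn , tH) ++ [])
        ≈ blockFormula β (pow tC a₁) (ι a₁ * pow tC (a₁ N.∸ 1))
                         (pow tG a₂) (ι a₂ * pow tG (a₂ N.∸ 1))
                         (pow tH a₃) (ι a₃ * pow tH (a₃ N.∸ 1))
    det-threeBlocks tC tG tH a₁ a₂ a₃ =
      trans (det-block₀ shared tC a₁ GH)
            (+-cong (*-congˡ (trans (det-block₀ onlyKm tG a₂ H) (+-cong (*-congˡ onlyH) (*-congˡ onlyKmH))))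
                    (*-congˡ (trans (det-block₁ zC onlyKm tG a₂ H) (+-cong (*-congˡ sharedH) (*-congˡ sharedKmH)))))
      where
      zC zG : Vertex
      zC = (shared , 0#)
      zG = (onlyKm , 0#)
      H : Vec Vertex (a₃ N.+ 0)
      H  = replicate a₃ (onlyKn , tH) ++ []
      GH : Vec Vertex (a₂ N.+ (a₃ N.+ 0))
      GH = replicate a₂ (onlyKm , tG) ++ H
      PH QH : Carrier
      PH = pow tH a₃
      QH = ι a₃ * pow tH (a₃ N.∸ 1)
      onlyH : detL H ≈ PH * 1# + QH * - β
      onlyH = trans (det-block₀ onlyKn tH a₃ []) (+-congˡ (*-congˡ det-onlyKn))
      onlyKmH : detL (zG ∷ H) ≈ PH * - β + QH * (β * β)
      onlyKmH = trans (det-block₁ zG onlyKn tH a₃ []) (+-cong (*-congˡ det-onlyKm) (*-congˡ det-onlyKm-onlyKn))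
      sharedH : detL (zC ∷ H) ≈ PH * - β + QH * 0#
      sharedH = trans (det-block₁ zC onlyKn tH a₃ []) (+-cong (*-congˡ det-shared) (*-congˡ det-shared-onlyKn))
      sharedKmH : detL (zC ∷ zG ∷ H) ≈ PH * 0# + QH * (β * (β * β))
      sharedKmH = trans (det-block₂ zC zG onlyKn tH a₃ []) (+-cong (*-congˡ det-shared-onlyKm) (*-congˡ det-all))

  module CharacteristicMatrix (m n k : ℕ) (k≤m : k ≤ m) (k≤n : k ≤ n) (α x : Carrier) where
    open Coalescence m n k k≤m k≤n
    open LabelledMatrices R (offDiagonal (1# - α)) using (Vertex; labelled; detL)
    open BlockDeterminants (1# - α) using (det-threeBlocks)

    -- Adding offDiagonal b b = − (1 − α) gives the diagonal entry λ − α·deg of the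
    -- characteristic matrix, as every vertex of block b has degree size b − 1.
    diagonal : Block → Carrier
    diagonal b = x - α * ι (size b) + 1#

    entry : ℕ → ℕ → Carrier
    entry i j = (if i ≡ᵇ j then 1# else 0#) * diagonal (block i) + offDiagonal (1# - α) (block i) (block j)

    δ≡ : ∀ {M} (u v : Fin M) → δ u v ≡ (if toℕ u ≡ᵇ toℕ v then 1# else 0#)
    δ≡ u v = cong (λ b → if b then 1# else 0#) (⌊≟⌋≡≡ᵇ u v)

    entryValue : ∀ (same : Bool) (b b′ : Block) d → (same ≡ true → b ≡ b′) →
      x * (if same then 1# else 0#)
        - (α * ((if same then 1# else 0#) * d) + (1# - α) * (if not same ∧ adjacentBlocks b b′ then 1# else 0#))
      ≈ (if same then 1# else 0#) * (x - α * (1# + d) + 1#) + (if adjacentBlocks b b′ then - (1# - α) else 0#)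
    entryValue true b b′ d b≡b′ rewrite b≡b′ refl | adjacentBlocks-refl b′ =
      solve 3 (λ x α d → x :* con (+ 1) :- (α :* (con (+ 1) :* d) :+ (con (+ 1) :- α) :* con (+ 0))
                         := con (+ 1) :* (x :- α :* (con (+ 1) :+ d) :+ con (+ 1)) :+ :- (con (+ 1) :- α)) ≈-refl x α d
    entryValue false b b′ d _ with adjacentBlocks b b′
    ... | true  = solve 3 (λ x α d → x :* con (+ 0) :- (α :* (con (+ 0) :* d) :+ (con (+ 1) :- α) :* con (+ 1))
                                     := con (+ 0) :* (x :- α :* (con (+ 1) :+ d) :+ con (+ 1)) :+ :- (con (+ 1) :- α)) ≈-refl x α d
    ... | false = solve 3 (λ x α d → x :* con (+ 0) :- (α :* (con (+ 0) :* d) :+ (con (+ 1) :- α) :* con (+ 0))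
                                     := con (+ 0) :* (x :- α :* (con (+ 1) :+ d) :+ con (+ 1)) :+ con (+ 0)) ≈-refl x α d

    charMatrix-entry : ∀ u v →
      x * δ u v - (α * (δ u v * ι (degree graph u)) + (1# - α) * (if graph u v then 1# else 0#)) ≈ entry (toℕ u) (toℕ v)
    charMatrix-entry u v rewrite δ≡ u v | adjacency u v =
      trans (entryValue (toℕ u ≡ᵇ toℕ v) (block (toℕ u)) (block (toℕ v)) (ι (degree graph u))
               (λ e → cong block (NP.≡ᵇ⇒≡ _ _ (Equivalence.from T-≡ e))))
            (+-congʳ (*-congˡ (+-congʳ (+-congˡ (-‿cong (*-congˡ (reflexive (cong ι (degree-suc u)))))))))

    vertices : Vec Vertex (k N.+ ((m N.∸ k) N.+ ((n N.∸ k) N.+ 0)))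
    vertices = replicate k (shared , diagonal shared)
            ++ replicate (m N.∸ k) (onlyKm , diagonal onlyKm)
            ++ replicate (n N.∸ k) (onlyKn , diagonal onlyKn) ++ []

    lookup-vertices : ∀ i → lookup vertices i ≡ (block (toℕ i) , diagonal (block (toℕ i)))
    lookup-vertices i =
      P.trans (lookup-replicate-++ k _ _ afterShared (lookup-replicate-++ (m N.∸ k) _ _ afterKm (lookup-replicate-++ (n N.∸ k) _ [] (λ _ → vₙ) (λ ()))) i)
              (byRegion (toℕ i))
      where
      vₙ : Vertex
      vₙ = (onlyKn , diagonal onlyKn)
      afterShared afterKm : ℕ → Vertex
      afterKm j = if j <ᵇ n N.∸ k then vₙ else vₙ
      afterShared j = if j <ᵇ m N.∸ k then (onlyKm , diagonal onlyKm) else afterKm (j N.∸ (m N.∸ k))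
      byRegion : ∀ j → (if j <ᵇ k then (shared , diagonal shared)
                        else (if j N.∸ k <ᵇ m N.∸ k then (onlyKm , diagonal onlyKm)
                        else (if j N.∸ k N.∸ (m N.∸ k) <ᵇ n N.∸ k then vₙ else vₙ)))
                     ≡ (block j , diagonal (block j))
      byRegion j with region j
      ... | sharedʳ j<k     rewrite <ᵇ-true j<k = refl
      ... | onlyKmʳ k≤j j<m rewrite <ᵇ-false k≤j | <ᵇ-true (NP.∸-monoˡ-< j<m k≤j) | <ᵇ-true j<m = refl
      ... | onlyKnʳ m≤j     rewrite <ᵇ-false (NP.≤-trans k≤m m≤j) | <ᵇ-false (NP.∸-monoˡ-≤ k m≤j)
                                  | if-same (j N.∸ k N.∸ (m N.∸ k) <ᵇ n N.∸ k) vₙ | <ᵇ-false m≤j = refl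

    ι-m : ι m ≈ ι k + ι (m N.∸ k)
    ι-m = trans (reflexive (cong ι (P.sym (NP.m+[n∸m]≡n k≤m)))) (ι-+ k _)

    ι-n : ι n ≈ ι k + ι (n N.∸ k)
    ι-n = trans (reflexive (cong ι (P.sym (NP.m+[n∸m]≡n k≤n)))) (ι-+ k _)

    ι-order : ι order ≈ ι k + (ι (m N.∸ k) + ι (n N.∸ k))
    ι-order = trans (reflexive (cong ι order≡)) (trans (ι-+ k _) (+-congˡ (ι-+ (m N.∸ k) (n N.∸ k))))

    ι-s : ι (m N.+ n N.∸ 2 N.* k) ≈ ι (m N.∸ k) + ι (n N.∸ k)
    ι-s = trans (reflexive (cong ι s≡)) (ι-+ (m N.∸ k) (n N.∸ k))
      where
      s≡ : m N.+ n N.∸ 2 N.* k ≡ (m N.∸ k) N.+ (n N.∸ k)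
      s≡ = P.trans (P.sym (NP.∸-+-assoc (m N.+ n) k (k N.+ 0)))
                   (P.trans (cong (order N.∸_) (NP.+-identityʳ k))
                            (P.trans (cong (N._∸ k) order≡) (NP.m+n∸m≡n k _)))

    diagonal-cong : ∀ b {s} → ι (size b) ≈ s → diagonal b ≈ x - α * s + 1#
    diagonal-cong b ι≈ = +-congʳ (+-congˡ (-‿cong (*-congˡ ι≈)))

    charPoly-vertices : Φ (Aα α graph) x ≈ detL vertices
    charPoly-vertices = trans (det-cong charMatrix-entry)
      (trans (reflexive (cong entryDet (P.trans order≡ (cong (λ z → k N.+ ((m N.∸ k) N.+ z)) (P.sym (NP.+-identityʳ (n N.∸ k)))))))
             (sym (det-cong vertex-entry)))
      where
      entryDet : ℕ → Carrier
      entryDet M = det {M} (λ u v → entry (toℕ u) (toℕ v))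
      vertex-entry : ∀ u v → labelled vertices u v ≈ entry (toℕ u) (toℕ v)
      vertex-entry u v rewrite lookup-vertices u | lookup-vertices v | δ≡ u v = ≈-refl

    charPoly-blockFormula : Φ (Aα α graph) x ≈
      blockFormula (1# - α) (pow (diagonal shared) k) (ι k * pow (diagonal shared) (k N.∸ 1))
                            (pow (diagonal onlyKm) (m N.∸ k)) (ι (m N.∸ k) * pow (diagonal onlyKm) (m N.∸ k N.∸ 1))
                            (pow (diagonal onlyKn) (n N.∸ k)) (ι (n N.∸ k) * pow (diagonal onlyKn) (n N.∸ k N.∸ 1))
    charPoly-blockFormula = trans charPoly-vertices
      (det-threeBlocks (diagonal shared) (diagonal onlyKm) (diagonal onlyKn) k (m N.∸ k) (n N.∸ k))

  blockFormula-scale : ∀ β PC QC PG QG PH QH d d′ →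
    blockFormula β PC QC PG QG PH QH * d * d′ ≈ blockFormula β PC QC (PG * d) (QG * d) (PH * d′) (QH * d′)
  blockFormula-scale = solve 9 (λ β PC QC PG QG PH QH d d′ →
    blockFormulaᴾ β PC QC PG QG PH QH :* d :* d′ := blockFormulaᴾ β PC QC (PG :* d) (QG :* d) (PH :* d′) (QH :* d′)) ≈-refl

  blockFormula-cong : ∀ β {PC PC′ QC QC′ PG PG′ QG QG′ PH PH′ QH QH′} →
    PC ≈ PC′ → QC ≈ QC′ → PG ≈ PG′ → QG ≈ QG′ → PH ≈ PH′ → QH ≈ QH′ →
    blockFormula β PC QC PG QG PH QH ≈ blockFormula β PC′ QC′ PG′ QG′ PH′ QH′
  blockFormula-cong β PC≈ QC≈ PG≈ QG≈ PH≈ QH≈ =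
    +-cong (*-cong PC≈ (+-cong (*-cong PG≈ (+-cong (*-congʳ PH≈) (*-congʳ QH≈)))
                               (*-cong QG≈ (+-cong (*-congʳ PH≈) (*-congʳ QH≈)))))
           (*-cong QC≈ (+-cong (*-cong PG≈ (+-cong (*-congʳ PH≈) (*-congʳ QH≈)))
                               (*-cong QG≈ (+-cong (*-congʳ PH≈) (*-congʳ QH≈)))))

  -- The factor (if m ≡ᵇ k then F else 1#) of the theorem makes up for the
  -- truncated exponent m ∸ k ∸ 1 when k = m.
  pow-clear : ∀ {m k} → k ≤ m → ∀ F → pow F (m N.∸ k) * (if m ≡ᵇ k then F else 1#) ≈ F * pow F (m N.∸ k N.∸ 1)
  pow-clear {ℕ.zero}  z≤n       F = trans (*-identityˡ F) (sym (*-identityʳ F))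
  pow-clear {ℕ.suc m} z≤n       F = *-identityʳ _
  pow-clear           (s≤s k≤m) F = pow-clear k≤m F

  ι-pow-clear : ∀ {m k} → k ≤ m → ∀ F →
    ι (m N.∸ k) * pow F (m N.∸ k N.∸ 1) * (if m ≡ᵇ k then F else 1#) ≈ ι (m N.∸ k) * pow F (m N.∸ k N.∸ 1)
  ι-pow-clear {ℕ.zero}  z≤n       F = trans (*-congʳ (zeroˡ _)) (trans (zeroˡ _) (sym (zeroˡ _)))
  ι-pow-clear {ℕ.suc m} z≤n       F = *-identityʳ _
  ι-pow-clear           (s≤s k≤m) F = ι-pow-clear k≤m F

  charPolyFormula : (x α ιm ιn ιk ιs ιq ιr X₁ X₂ X₃ : Carrier) → Carrier
  charPolyFormula x α ιm ιn ιk ιs ιq ιr X₁ X₂ X₃ =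
    X₁ * X₂ * X₃ * ((x - ιm + 1# + (1# - α) * ιk) * (x - ιn + 1# + (1# - α) * ιk) * (x - α * ιs + 1# - ιk)
                    - pow (1# - α) 2 * ιk * (ιs * x - ιs * α * ιk - ιq * (ιr - 1#) - ιr * (ιq - 1#)))

  charPolyFormula-cong : ∀ x α {ιm ιm′ ιn ιn′ ιs ιs′} ιk ιq ιr X₁ X₂ X₃ → ιm ≈ ιm′ → ιn ≈ ιn′ → ιs ≈ ιs′ →
    charPolyFormula x α ιm ιn ιk ιs ιq ιr X₁ X₂ X₃ ≈ charPolyFormula x α ιm′ ιn′ ιk ιs′ ιq ιr X₁ X₂ X₃
  charPolyFormula-cong x α ιk ιq ιr X₁ X₂ X₃ ιm≈ ιn≈ ιs≈ =
    *-congˡ (+-cong (*-cong (*-cong (+-congʳ (+-congʳ (+-congˡ (-‿cong ιm≈))))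
                                    (+-congʳ (+-congʳ (+-congˡ (-‿cong ιn≈)))))
                            (+-congʳ (+-congʳ (+-congˡ (-‿cong (*-congˡ ιs≈))))))
                    (-‿cong (*-congˡ (+-congʳ (+-congʳ (+-cong (*-congʳ ιs≈) (-‿cong (*-congʳ (*-congʳ ιs≈)))))))))

  blockFormula-charPoly : ∀ x α K Q R X₁ X₂ X₃ →
    blockFormula (1# - α) ((x - α * (K + (Q + R)) + 1#) * X₁) (K * X₁)
                          ((x - α * (K + Q) + 1#) * X₂) (Q * X₂) ((x - α * (K + R) + 1#) * X₃) (R * X₃)
      ≈ charPolyFormula x α (K + Q) (K + R) K (Q + R) Q R X₁ X₂ X₃
  blockFormula-charPoly = solve 8 (λ x α K Q R X₁ X₂ X₃ →
    let one = con (+ 1)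
        β = one :- α
        F : Polynomial 8 → Polynomial 8
        F size = x :- α :* size :+ one
    in blockFormulaᴾ β (F (K :+ (Q :+ R)) :* X₁) (K :* X₁) (F (K :+ Q) :* X₂) (Q :* X₂) (F (K :+ R) :* X₃) (R :* X₃)
       := X₁ :* X₂ :* X₃ :* ((x :- (K :+ Q) :+ one :+ β :* K) :* (x :- (K :+ R) :+ one :+ β :* K) :* (x :- α :* (Q :+ R) :+ one :- K)
                             :- β :* (β :* one) :* K
                                :* ((Q :+ R) :* x :- (Q :+ R) :* α :* K :- Q :* (R :- one) :- R :* (Q :- one)))) ≈-refl

mainTheorem12 : {c ℓ : Level} (R : CommutativeRing c ℓ) (m n k : ℕ)
    → 1 < m → 1 < n → 1 ≤ k → k ≤ m → k ≤ n
    → (α x : CommutativeRing.Carrier R)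
    → let open CommutativeRing R
          open RingDefs R
          -- λ - α m + 1  and  λ - α n + 1
          Fm = x - α * ι m + 1#
          Fn = x - α * ι n + 1#
          -- cleared denominators for the exponent m-k-1 = -1 (k = m), n-k-1 = -1 (k = n)
          Dm = if m ≡ᵇ k then Fm else 1#
          Dn = if n ≡ᵇ k then Fn else 1#
          s = m N.+ n N.∸ 2 N.* k
          P = (x - ι m + 1# + (1# - α) * ι k)
              * (x - ι n + 1# + (1# - α) * ι k)
              * (x - α * ι s + 1# - ι k)
          S = ι s * x - ι s * α * ι k
              - ι (m N.∸ k) * (ι (n N.∸ k) - 1#)
              - ι (n N.∸ k) * (ι (m N.∸ k) - 1#)
          rhs = pow (x - α * ι (m N.+ n N.∸ k) + 1#) (k N.∸ 1)
                * pow Fm (m N.∸ k N.∸ 1)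
                * pow Fn (n N.∸ k N.∸ 1)
                * (P - pow (1# - α) 2 * ι k * S)
      in Φ (Aα α (coalesce (complete m) (complete n) k)) x * Dm * Dn ≈ rhs
mainTheorem12 R m n ℕ.zero      _ _ () _   _   α x
mainTheorem12 R m n k@(ℕ.suc _) _ _ _  k≤m k≤n α x = begin
  Φ (Aα α graph) x * Dm * Dn
    ≈⟨ *-congʳ (*-congʳ charPoly-blockFormula) ⟩
  blockFormula β (pow Fk k) (ι k * X₁) (pow Fm q) (ι q * X₂) (pow Fn r) (ι r * X₃) * Dm * Dn
    ≈⟨ blockFormula-scale β _ _ _ _ _ _ Dm Dn ⟩
  blockFormula β (pow Fk k) (ι k * X₁) (pow Fm q * Dm) (ι q * X₂ * Dm) (pow Fn r * Dn) (ι r * X₃ * Dn)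
    ≈⟨ blockFormula-cong β (*-congʳ (diagonal-cong shared ι-order)) ≈-refl
                           (trans (pow-clear k≤m Fm) (*-congʳ (diagonal-cong onlyKm ι-m))) (ι-pow-clear k≤m Fm)
                           (trans (pow-clear k≤n Fn) (*-congʳ (diagonal-cong onlyKn ι-n))) (ι-pow-clear k≤n Fn) ⟩
  blockFormula β ((x - α * (ι k + (ι q + ι r)) + 1#) * X₁) (ι k * X₁)
                 ((x - α * (ι k + ι q) + 1#) * X₂) (ι q * X₂) ((x - α * (ι k + ι r) + 1#) * X₃) (ι r * X₃)
    ≈⟨ blockFormula-charPoly x α (ι k) (ι q) (ι r) X₁ X₂ X₃ ⟩
  charPolyFormula x α (ι k + ι q) (ι k + ι r) (ι k) (ι q + ι r) (ι q) (ι r) X₁ X₂ X₃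
    ≈⟨ charPolyFormula-cong x α (ι k) (ι q) (ι r) X₁ X₂ X₃ (sym ι-m) (sym ι-n) (sym ι-s) ⟩
  charPolyFormula x α (ι m) (ι n) (ι k) (ι (m N.+ n N.∸ 2 N.* k)) (ι q) (ι r) X₁ X₂ X₃
    ∎
  where
  open CommutativeRing R renaming (refl to ≈-refl)
  open RingDefs R
  open CharacteristicPolynomial R
  open CharacteristicMatrix m n k k≤m k≤n α x
  open Coalescence m n k k≤m k≤n using (graph)
  open SetoidReasoning setoid
  β Fk Fm Fn X₁ X₂ X₃ Dm Dn : CommutativeRing.Carrier R
  q r : ℕ
  β = 1# - α
  q = m N.∸ k
  r = n N.∸ k
  Fk = diagonal shared
  Fm = diagonal onlyKm
  Fn = diagonal onlyKn
  X₁ = pow Fk (k N.∸ 1)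
  X₂ = pow Fm (q N.∸ 1)
  X₃ = pow Fn (r N.∸ 1)
  Dm = if m ≡ᵇ k then Fm else 1#
  Dn = if n ≡ᵇ k then Fn else 1#
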